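{- Let $G$ be a finite abelian $p$-group with $p^dG=0$ and let $\cdot:G\times G\to R=\mathbb{Z}/p^d\mathbb{Z}$ be the pairing defined below. Consider the four choices, writing $\mathbf{g}_k=(g_k,h_k)\in G^2$: (1) $\Omega=\Omega_1$, $U_1(\mathbf{g}_k)=g_k\cdot h_k$, $B_1(\mathbf{g}_k,\mathbf{g}_l)=g_k\cdot h_l$; (2) $\Omega=\Omega_2$, $U_2(\mathbf{g}_k)=g_k\cdot h_k$, $B_2(\mathbf{g}_k,\mathbf{g}_l)=g_k\cdot h_l+g_l\cdot h_k$; (3) $\Omega=\Omega_2$, $U_3=0$, $B_3(\mathbf{g}_k,\mathbf{g}_l)=g_k\cdot h_l-g_l\cdot h_k$; (4) $\Omega=\Omega_2$, $U_4=0$, $B_4(\mathbf{g}_k,\mathbf{g}_l)=-(g_k-g_l)\cdot(h_k-h_l)$. In each of the cases (1)–(4), the pairing $B$ satisfies conditions (i), (ii) and (iii) below (condition (iii) being vacuous in case (1)).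
   Context: $R=\mathbb{Z}/p^d\mathbb{Z}$. Write $G=\mathbb{Z}/p^{d_1}\mathbb{Z}\times\cdots\times\mathbb{Z}/p^{d_r}\mathbb{Z}$ with $d\ge d_1\ge\cdots\ge d_r\ge1$ and define $(x_1,\dots,x_r)\cdot(y_1,\dots,y_r)=\sum_{i}p^{d-d_i}x_iy_i \bmod p^d$ (a nondegenerate $R$-bilinear pairing). $\Omega_1=\{(k,l)\in[n]^2:k\ne l\}$, $\Omega_2=\{(k,l)\in[n]^2:k<l\}$. For a map $B:G^2\times G^2\to R$, a subset $W\subseteq G^2$ is isotropic if $B(\mathbf{g},\mathbf{g}')=0$ for all $\mathbf{g},\mathbf{g}'\in W$. Conditions: (i) the maximal possible cardinality of an isotropic subset of $G^2$ is $|G|$; (ii) if an isotropic subset $W\subseteq G^2$ has exactly $|G|$ elements, then $W=\mathbf{g}'+H$ for some subgroup $H\le G^2$ and $\mathbf{g}'\in G^2$, and for every $\mathbf{g}\notin W$, at least one of the maps $H\to R$, $x\mapsto B(\mathbf{g}'+x,\mathbf{g})$ or $x\mapsto B(\mathbf{g},\mathbf{g}'+x)$, is a non-constant affine map; (iii) if $\Omega=\Omega_2$ then $B$ is symmetric or alternating. -}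

module Defs where

open import Level using (0ℓ)
open import Data.Nat using (ℕ; zero; suc; _+_; _*_; _∸_; _^_; _≤_; NonZero)
open import Data.Nat.Properties using (m^n≢0)
open import Data.Nat.DivMod using (_mod_)
open import Data.Fin using (Fin; toℕ)
open import Data.List using (List; []; _∷_; length; map)
open import Data.Nat.ListAction using (product)
open import Data.List.Membership.Propositional using (_∈_; _∉_)
open import Data.List.Relation.Unary.Unique.Propositional using (Unique)
open import Data.Product using (Σ; ∃; ∃-syntax; _×_; _,_)
open import Data.Sum using (_⊎_)
open import Relation.Binary.PropositionalEquality using (_≡_; _≢_)
open import Function.Bundles using (_⇔_)

-- The two index sets Ω₁ = {k ≠ l}, Ω₂ = {k < l}; only which one is used matters.
data OmegaKind : Set where
  Ω₁ Ω₂ : OmegaKind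

data Case : Set where
  case1 case2 case3 case4 : Case

omega : Case → OmegaKind
omega case1 = Ω₁
omega case2 = Ω₂
omega case3 = Ω₂
omega case4 = Ω₂

module ModArith (n : ℕ) .{{_ : NonZero n}} where
  0F : Fin n
  0F = 0 mod n

  _+F_ : Fin n → Fin n → Fin n
  a +F b = (toℕ a + toℕ b) mod n

  -F_ : Fin n → Fin n
  -F a = (n ∸ toℕ a) mod n

  _-F_ : Fin n → Fin n → Fin n
  a -F b = a +F (-F b)

module Setup (p : ℕ) .{{_ : NonZero p}} where

  R : ℕ → Set
  R d = Fin (p ^ d)

  -- G = ℤ/p^{d_1} × ⋯ × ℤ/p^{d_r}, for ds = d_1 ∷ ⋯ ∷ d_r ∷ []
  data GElt : List ℕ → Set where
    []  : GElt []
    _∷_ : ∀ {e es} → Fin (p ^ e) → GElt es → GElt (e ∷ es)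

  card : List ℕ → ℕ
  card ds = product (map (p ^_) ds)

  _+G_ : ∀ {ds} → GElt ds → GElt ds → GElt ds
  [] +G [] = []
  (_∷_ {e} x xs) +G (y ∷ ys) = ModArith._+F_ (p ^ e) {{m^n≢0 p e}} x y ∷ (xs +G ys)

  -G_ : ∀ {ds} → GElt ds → GElt ds
  -G [] = []
  -G (_∷_ {e} x xs) = ModArith.-F_ (p ^ e) {{m^n≢0 p e}} x ∷ (-G xs)

  _-G_ : ∀ {ds} → GElt ds → GElt ds → GElt ds
  x -G y = x +G (-G y)

  0G : ∀ ds → GElt ds
  0G [] = []
  0G (e ∷ es) = ModArith.0F (p ^ e) {{m^n≢0 p e}} ∷ 0G es

  dotℕ : ∀ (d : ℕ) {ds} → GElt ds → GElt ds → ℕ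
  dotℕ d [] [] = 0
  dotℕ d (_∷_ {e} x xs) (y ∷ ys) = p ^ (d ∸ e) * toℕ x * toℕ y + dotℕ d xs ys

  dot : ∀ (d : ℕ) {ds} → GElt ds → GElt ds → R d
  dot d x y = (dotℕ d x y) mod (p ^ d)
    where instance _ = m^n≢0 p d

  G² : List ℕ → Set
  G² ds = GElt ds × GElt ds

  _+²_ : ∀ {ds} → G² ds → G² ds → G² ds
  (g , h) +² (g' , h') = (g +G g') , (h +G h')

  -²_ : ∀ {ds} → G² ds → G² ds
  -² (g , h) = (-G g) , (-G h)

  0² : ∀ ds → G² ds
  0² ds = 0G ds , 0G ds

  B : ∀ (d : ℕ) {ds} → Case → G² ds → G² ds → R d
  B d case1 (gk , hk) (gl , hl) = dot d gk hl
  B d case2 (gk , hk) (gl , hl) = ModArith._+F_ (p ^ d) {{m^n≢0 p d}} (dot d gk hl) (dot d gl hk)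
  B d case3 (gk , hk) (gl , hl) = ModArith._-F_ (p ^ d) {{m^n≢0 p d}} (dot d gk hl) (dot d gl hk)
  B d case4 (gk , hk) (gl , hl) = ModArith.-F_ (p ^ d) {{m^n≢0 p d}} (dot d (gk -G gl) (hk -G hl))

  module Conditions (d : ℕ) (ds : List ℕ) (Bf : G² ds → G² ds → R d) where
    open ModArith (p ^ d) {{m^n≢0 p d}}

    -- A finite subset W ⊆ G² is represented by a duplicate-free list; |W| = length W.
    Isotropic : List (G² ds) → Set
    Isotropic W = ∀ {x y} → x ∈ W → y ∈ W → Bf x y ≡ 0F

    IsSubgroup : (G² ds → Set) → Set
    IsSubgroup H = H (0² ds)
                 × (∀ {x y} → H x → H y → H (x +² y))
                 × (∀ {x} → H x → H (-² x))

    IsAffineOn : (G² ds → Set) → (G² ds → R d) → Set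
    IsAffineOn H f =
      Σ (G² ds → R d) λ φ →
        (∀ {x y} → H x → H y → φ (x +² y) ≡ φ x +F φ y)
        × Σ (R d) λ c → ∀ {x} → H x → f x ≡ φ x +F c

    NonConstantAffineOn : (G² ds → Set) → (G² ds → R d) → Set
    NonConstantAffineOn H f =
      IsAffineOn H f × (∃[ x ] ∃[ y ] (H x × H y × f x ≢ f y))

    CondI : Set
    CondI = (∀ (W : List (G² ds)) → Unique W → Isotropic W → length W ≤ card ds)
          × (∃[ W ] (Unique W × Isotropic W × length W ≡ card ds))

    CondII : Set₁
    CondII = ∀ (W : List (G² ds)) → Unique W → Isotropic W → length W ≡ card ds →
      Σ (G² ds → Set) λ H → IsSubgroup H × Σ (G² ds) λ g' →
        (∀ x → (x ∈ W) ⇔ (∃[ h ] (H h × x ≡ g' +² h)))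
        × (∀ g → g ∉ W →
             NonConstantAffineOn H (λ x → Bf (g' +² x) g)
           ⊎ NonConstantAffineOn H (λ x → Bf g (g' +² x)))

    Symmetric : Set
    Symmetric = ∀ x y → Bf x y ≡ Bf y x

    Alternating : Set
    Alternating = ∀ x → Bf x x ≡ 0F

    CondIII : OmegaKind → Set
    CondIII Ω = Ω ≡ Ω₂ → Symmetric ⊎ Alternating

-- The key fact is an uncertainty principle: if B is a biadditive form on a finite abelian
-- group G with values in ℤ/p^d that is nondegenerate on the left, then |A|·|A⊥| ≤ |G| for
-- every subgroup A. By induction on |A|: some t makes B(−, t) map A to a nonzero subgroup
-- of the p-torsion of ℤ/p^d, which has at most p elements. Then A′ = A ∩ ker B(−, t) has
-- index at most p in A, while the translates A⊥ + k t (k < p) are disjoint and lie in A′⊥.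
--
-- For the reflexive forms B₂ and B₃ on G², an isotropic W lies in the isotropic subgroup
-- C = W⊥⊥, so |C|² ≤ |C|·|C⊥| ≤ |G|², and |W| = |G| forces W = C = C⊥: every g ∉ W pairs
-- nontrivially with some element of C. For B₁, W lies in A × A⊥ with A the annihilator of
-- the second coordinates of W. For B₄, B₄(x, y) = −Q(x − y) with Q(g, h) = g·h, whose polar
-- form is B₂, so translating W to contain 0 makes it B₂-isotropic.

module Submission where

open import Level using (0ℓ)
open import Data.Empty using (⊥-elim)
open import Data.Sum using (_⊎_; inj₁; inj₂)
open import Data.Product using (∃; ∃-syntax; _×_; _,_; proj₁; proj₂)
open import Data.Product.Properties using (≡-dec)
open import Data.Maybe using (fromMaybe)
open import Function using (_∘_; id)
open import Function.Bundles using (_⇔_; mk⇔)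
open import Relation.Binary.Definitions using (DecidableEquality)
open import Relation.Binary.PropositionalEquality
  using (_≡_; _≢_; refl; sym; trans; cong; cong₂; subst; subst₂; isEquivalence; module ≡-Reasoning)
import Relation.Binary.Reasoning.Setoid as SetoidReasoning
open import Relation.Nullary using (Dec; yes; no; ¬_)
open import Relation.Nullary.Decidable using (_×-dec_; _→-dec_; ¬?; decidable-stable)
open import Relation.Unary using (Pred; Decidable)

import Data.Nat as ℕ
open import Data.Nat
  using (ℕ; zero; suc; _+_; _*_; _∸_; _^_; _%_; _≤_; _<_; _≥_; z≤n; s≤s; s≤s⁻¹; NonZero; >-nonZero; >-nonZero⁻¹)
open import Data.Nat.Properties
  using ( +-comm; +-assoc; +-identityʳ; *-comm; *-assoc; *-identityˡ; *-identityʳ; *-zeroʳ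
        ; m+[n∸m]≡n; m∸n≤m; m∸n≡0⇒m≤n; ^-distribˡ-+-*; m^n≢0; m*n≢0; m*n≡0⇒m≡0; n≢0⇒n>0; n<1⇒n≡0
        ; ≤-refl; ≤-reflexive; ≤-trans; ≤-antisym; ≤-total; <⇒≤; <⇒≢; <⇒≱; ≮⇒≥; ≤-<-trans; <-≤-trans
        ; *-monoˡ-≤; *-monoʳ-≤; *-mono-<; *-cancelˡ-≤; *-cancelʳ-<; module ≤-Reasoning)
open import Data.Nat.DivMod
  using (_mod_; m%n<n; m%n%n≡m%n; m<n⇒m%n≡m; n%n≡0; m*n%n≡0; %-distribˡ-+; %-distribˡ-*; %-congʳ; m%n*o≡m*o%[n*o])
open import Data.Nat.Divisibility using (_∣_; divides; *-cancelˡ-∣; m%n≡0⇒n∣m)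
open import Data.Nat.Primality using (Prime; prime⇒nonZero)
open import Data.Nat.Coprimality using (Coprime; coprime-Bézout; prime⇒coprime)
open import Data.Nat.GCD using (module Bézout)
open import Data.Nat.Tactic.RingSolver using (solve-∀)
import Data.Fin
open import Data.Fin using (Fin; toℕ)
open import Data.Fin.Properties using (toℕ-injective; toℕ<n; toℕ-fromℕ<)

open import Data.List
  using (List; []; _∷_; length; map; filter; head; _++_; upTo; applyUpTo; allFin; cartesianProductWith; cartesianProduct)
open import Data.List.Properties using (length-map; length-++; length-removeAt′; length-upTo; length-applyUpTo; length-tabulate)
open import Data.List.Membership.Propositional using (_∈_; _∉_; _─_)
open import Data.List.Membership.Propositional.Properties
  using ( ∈-map⁺; ∈-map⁻; ∈-filter⁺; ∈-filter⁻; ∈-length; ∈-upTo⁻; ∈-applyUpTo⁺; ∈-allFin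
        ; ∈-cartesianProductWith⁺; ∈-cartesianProduct⁺; ∈-cartesianProduct⁻)
open import Data.List.Relation.Binary.Subset.Propositional using (_⊆_)
open import Data.List.Relation.Unary.Any as Any using (Any; here; there; any?; satisfied)
open import Data.List.Relation.Unary.All as All using (All; []; _∷_; all?)
open import Data.List.Relation.Unary.All.Properties using (¬Any⇒All¬)
open import Data.List.Relation.Unary.AllPairs using ([]; _∷_)
open import Data.List.Relation.Unary.Linked using (Linked)
open import Data.List.Relation.Unary.Unique.Propositional using (Unique)
open import Data.List.Relation.Unary.Unique.Propositional.Properties
  using (map⁺; filter⁺; upTo⁺; allFin⁺; cartesianProductWith⁺; cartesianProduct⁺)

open import Algebra.Core using (Op₁; Op₂)
open import Algebra.Bundles using (AbelianGroup)
import Algebra.Definitions as Definitions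
import Algebra.Structures as Structures
open import Algebra.Consequences.Propositional using (comm∧idˡ⇒id; comm∧invʳ⇒inv)
import Algebra.Definitions.RawMonoid as RawMonoidDefinitions
import Algebra.Properties.Group as GroupProperties
import Algebra.Properties.AbelianGroup as AbelianGroupProperties
import Algebra.Properties.CommutativeSemigroup as CommutativeSemigroupProperties
import Algebra.Properties.Monoid.Mult as MonoidMultProperties
import Algebra.Properties.CommutativeMonoid.Mult as CommutativeMonoidMultProperties

open import Defs

m*m≤n*n⇒m≤n : ∀ {m n} → m * m ≤ n * n → m ≤ n
m*m≤n*n⇒m≤n m*m≤n*n = ≮⇒≥ λ n<m → <⇒≱ (*-mono-< n<m n<m) m*m≤n*n

∃-boundary : ∀ {P : Pred ℕ 0ℓ} → Decidable P → P 0 → ∀ {m} → ¬ P m → ∃ λ j → P j × ¬ P (suc j)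
∃-boundary P? P0 {zero}  ¬P0 = ⊥-elim (¬P0 P0)
∃-boundary P? P0 {suc m} ¬Pm with P? m
... | yes Pm  = m , Pm , ¬Pm
... | no  ¬Pm′ = ∃-boundary P? P0 ¬Pm′

-- Lists and counting in finite types

module _ {A : Set} where

  ∈-─⁺ : ∀ {x y} {ys : List A} (x∈ys : x ∈ ys) → y ∈ ys → y ≢ x → y ∈ ys ─ x∈ys
  ∈-─⁺ (here refl) (here refl)   y≢x = ⊥-elim (y≢x refl)
  ∈-─⁺ (here _)    (there y∈ys)  _   = y∈ys
  ∈-─⁺ (there _)   (here refl)   _   = here refl
  ∈-─⁺ (there x∈ys) (there y∈ys) y≢x = there (∈-─⁺ x∈ys y∈ys y≢x)

  unique-⊆⇒length≤ : ∀ {xs ys : List A} → Unique xs → xs ⊆ ys → length xs ≤ length ys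
  unique-⊆⇒length≤ {[]}     _              _  = z≤n
  unique-⊆⇒length≤ {x ∷ xs} {ys} (x≢xs ∷ xs!) xs⊆ys =
    subst (suc (length xs) ≤_) (sym (length-removeAt′ ys _))
      (s≤s (unique-⊆⇒length≤ xs! λ y∈xs →
        ∈-─⁺ x∈ys (xs⊆ys (there y∈xs)) λ { refl → All.lookup x≢xs y∈xs refl }))
    where x∈ys = xs⊆ys (here refl)

  unique-⊆⇒length< : ∀ {xs ys : List A} {y} → Unique xs → xs ⊆ ys → y ∈ ys → y ∉ xs →
                     length xs < length ys
  unique-⊆⇒length< {xs} xs! xs⊆ys y∈ys y∉xs =
    unique-⊆⇒length≤ (¬Any⇒All¬ xs y∉xs ∷ xs!) λ { (here refl) → y∈ys ; (there z∈xs) → xs⊆ys z∈xs }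

  map⁺-injectiveOn : ∀ {B : Set} (f : A → B) {xs : List A} → Unique xs →
                     (∀ {x y} → x ∈ xs → y ∈ xs → f x ≡ f y → x ≡ y) → Unique (map f xs)
  map⁺-injectiveOn f {[]}     _            _   = []
  map⁺-injectiveOn f {x ∷ xs} (x≢xs ∷ xs!) inj =
    All.tabulate (fx∉ ∘ ∈-map⁻ f) ∷ map⁺-injectiveOn f xs! (λ x∈ y∈ → inj (there x∈) (there y∈))
    where
    fx∉ : ∀ {z} → ∃ (λ y → y ∈ xs × z ≡ f y) → f x ≢ z
    fx∉ (y , y∈xs , refl) fx≡fy = All.lookup x≢xs y∈xs (inj (here refl) (there y∈xs) fx≡fy)

  length-cartesianProductWith : ∀ {B C : Set} (f : A → B → C) xs ys →
                                length (cartesianProductWith f xs ys) ≡ length xs * length ys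
  length-cartesianProductWith f []       ys = refl
  length-cartesianProductWith f (x ∷ xs) ys = begin
    length (map (f x) ys ++ cartesianProductWith f xs ys)          ≡⟨ length-++ (map (f x) ys) ⟩
    length (map (f x) ys) + length (cartesianProductWith f xs ys)
      ≡⟨ cong₂ _+_ (length-map (f x) ys) (length-cartesianProductWith f xs ys) ⟩
    length ys + length xs * length ys                              ∎
    where open ≡-Reasoning

  ∈⇒head∈ : ∀ {x z : A} {xs} → x ∈ xs → fromMaybe z (head xs) ∈ xs
  ∈⇒head∈ (here _)  = here refl
  ∈⇒head∈ (there _) = here refl

module _ {A : Set} (_≟_ : DecidableEquality A) where
  open import Data.List.Membership.DecPropositional _≟_ using (_∈?_)

  unique-⊆-length≥⇒⊇ : ∀ {xs ys : List A} → Unique xs → xs ⊆ ys → length ys ≤ length xs → ys ⊆ xs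
  unique-⊆-length≥⇒⊇ {xs} xs! xs⊆ys ys≤xs {y} y∈ys with y ∈? xs
  ... | yes y∈xs = y∈xs
  ... | no  y∉xs = ⊥-elim (<⇒≱ (unique-⊆⇒length< xs! xs⊆ys y∈ys y∉xs) ys≤xs)

module Counting {A : Set} (_≟_ : DecidableEquality A) (elems : List A)
                (∈-elems : ∀ x → x ∈ elems) (elems! : Unique elems) where

  ∀? : {P : Pred A 0ℓ} → Decidable P → Dec (∀ x → P x)
  ∀? P? with all? P? elems
  ... | yes all = yes (All.lookup all ∘ ∈-elems)
  ... | no ¬all = no (¬all ∘ All.tabulate ∘ λ ∀P {x} _ → ∀P x)

  ∃? : {P : Pred A 0ℓ} → Decidable P → Dec (∃ P)
  ∃? P? with any? P? elems
  ... | yes any = yes (satisfied any)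
  ... | no ¬any = no λ (x , Px) → ¬any (Any.map (λ { refl → Px }) (∈-elems x))

  listOf : {P : Pred A 0ℓ} → Decidable P → List A
  listOf P? = filter P? elems

  count : {P : Pred A 0ℓ} → Decidable P → ℕ
  count P? = length (listOf P?)

  module _ {P : Pred A 0ℓ} (P? : Decidable P) where

    listOf! : Unique (listOf P?)
    listOf! = filter⁺ P? elems!

    ∈-listOf⁺ : ∀ {x} → P x → x ∈ listOf P?
    ∈-listOf⁺ = ∈-filter⁺ P? (∈-elems _)

    ∈-listOf⁻ : ∀ {x} → x ∈ listOf P? → P x
    ∈-listOf⁻ = proj₂ ∘ ∈-filter⁻ P? {xs = elems}

    count≤length : ∀ {ys} → (∀ {x} → P x → x ∈ ys) → count P? ≤ length ys
    count≤length P⊆ys = unique-⊆⇒length≤ listOf! (P⊆ys ∘ ∈-listOf⁻)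

    length≤count : ∀ {xs} → Unique xs → (∀ {x} → x ∈ xs → P x) → length xs ≤ count P?
    length≤count xs! xs⊆P = unique-⊆⇒length≤ xs! (∈-listOf⁺ ∘ xs⊆P)

    count≤length⇒⊆ : ∀ {xs} → Unique xs → (∀ {x} → x ∈ xs → P x) → count P? ≤ length xs →
                     ∀ {x} → P x → x ∈ xs
    count≤length⇒⊆ xs! xs⊆P P≤xs = unique-⊆-length≥⇒⊇ _≟_ xs! (∈-listOf⁺ ∘ xs⊆P) P≤xs ∘ ∈-listOf⁺

  module _ {P Q : Pred A 0ℓ} (P? : Decidable P) (Q? : Decidable Q) (P⊆Q : ∀ {x} → P x → Q x) where

    count-mono : count P? ≤ count Q?
    count-mono = count≤length P? (∈-listOf⁺ Q? ∘ P⊆Q)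

    count-mono-< : ∀ {x} → Q x → ¬ P x → count P? < count Q?
    count-mono-< Qx ¬Px = unique-⊆⇒length< (listOf! P?) (∈-listOf⁺ Q? ∘ P⊆Q ∘ ∈-listOf⁻ P?)
                            (∈-listOf⁺ Q? Qx) (¬Px ∘ ∈-listOf⁻ P?)

    count≤⇒⊇ : count Q? ≤ count P? → ∀ {x} → Q x → P x
    count≤⇒⊇ Q≤P = ∈-listOf⁻ P? ∘ count≤length⇒⊆ Q? (listOf! P?) (P⊆Q ∘ ∈-listOf⁻ P?) Q≤P

-- Abelian groups

module _ {A : Set} {_∙_ : Op₂ A} {ε : A} {_⁻¹ : Op₁ A} where
  open Definitions {A = A} _≡_
  open Structures {A = A} _≡_

  isAbelianGroup-≡ : Associative _∙_ → Commutative _∙_ → LeftIdentity ε _∙_ →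
                     RightInverse ε _⁻¹ _∙_ → IsAbelianGroup _∙_ ε _⁻¹
  isAbelianGroup-≡ assoc comm idˡ invʳ = record
    { isGroup = record
      { isMonoid = record
        { isSemigroup = record { isMagma = record { isEquivalence = isEquivalence ; ∙-cong = cong₂ _∙_ }
                               ; assoc = assoc }
        ; identity = comm∧idˡ⇒id comm idˡ }
      ; inverse = comm∧invʳ⇒inv comm invʳ
      ; ⁻¹-cong = cong _⁻¹ }
    ; comm = comm }

module _ {a ℓ} (G : AbelianGroup a ℓ) where
  open AbelianGroup G
    using ( _≈_; _≉_; _∙_; _⁻¹; _-_; ε; setoid; rawMonoid; monoid; commutativeMonoid; commutativeSemigroup
          ; comm; assoc; identityˡ; identityʳ; inverseˡ; inverseʳ; ∙-congˡ; ∙-congʳ)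
  open AbelianGroupProperties G using (∙-cancelˡ; identityʳ-unique; ⁻¹-∙-comm; ⁻¹-anti-homo‿-)
  open CommutativeSemigroupProperties commutativeSemigroup using (interchange)
  open RawMonoidDefinitions rawMonoid using () renaming (_×_ to _·_)
  open MonoidMultProperties monoid using (×-homo-+; ×-assocˡ; ×-congʳ)
  open CommutativeMonoidMultProperties commutativeMonoid using (×-distrib-+)
  open SetoidReasoning setoid

  ·-zeroʳ : ∀ n → n · ε ≈ ε
  ·-zeroʳ n = identityʳ-unique (n · ε) (n · ε) (begin
    n · ε ∙ n · ε  ≈⟨ ×-distrib-+ ε ε n ⟨
    n · (ε ∙ ε)    ≈⟨ ×-congʳ n (identityˡ ε) ⟩
    n · ε          ∎)

  ·-annihilates-multiples : ∀ {x} m c → m · x ≈ ε → (c ℕ.* m) · x ≈ ε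
  ·-annihilates-multiples {x} m c mx≈ε = begin
    (c ℕ.* m) · x  ≈⟨ ×-assocˡ x c m ⟨
    c · (m · x)    ≈⟨ ×-congʳ c mx≈ε ⟩
    c · ε          ≈⟨ ·-zeroʳ c ⟩
    ε              ∎

  coprime-annihilators⇒≈ε : ∀ {x m n} → Coprime m n → m · x ≈ ε → n · x ≈ ε → x ≈ ε
  coprime-annihilators⇒≈ε {x} {m} {n} m⊥n mx≈ε nx≈ε with coprime-Bézout m⊥n
  ... | Bézout.+- a b 1+bn≡am = begin
    x                    ≈⟨ identityʳ x ⟨
    x ∙ ε                ≈⟨ ∙-congˡ (·-annihilates-multiples n b nx≈ε) ⟨
    suc (b ℕ.* n) · x    ≡⟨ cong (_· x) 1+bn≡am ⟩
    (a ℕ.* m) · x        ≈⟨ ·-annihilates-multiples m a mx≈ε ⟩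
    ε                    ∎
  ... | Bézout.-+ a b 1+am≡bn = begin
    x                    ≈⟨ identityʳ x ⟨
    x ∙ ε                ≈⟨ ∙-congˡ (·-annihilates-multiples m a mx≈ε) ⟨
    suc (a ℕ.* m) · x    ≡⟨ cong (_· x) 1+am≡bn ⟩
    (b ℕ.* n) · x        ≈⟨ ·-annihilates-multiples n b nx≈ε ⟩
    ε                    ∎

  ·-difference : ∀ {x k k'} → k ℕ.≤ k' → k · x ≈ k' · x → (k' ∸ k) · x ≈ ε
  ·-difference {x} {k} {k'} k≤k' kx≈k'x = ∙-cancelˡ (k · x) ((k' ∸ k) · x) ε (begin
    k · x ∙ (k' ∸ k) · x   ≈⟨ ×-homo-+ x k (k' ∸ k) ⟨
    (k ℕ.+ (k' ∸ k)) · x   ≡⟨ cong (_· x) (m+[n∸m]≡n k≤k') ⟩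
    k' · x                 ≈⟨ kx≈k'x ⟨
    k · x                  ≈⟨ identityʳ (k · x) ⟨
    k · x ∙ ε              ∎)

  module _ {p x} (p-prime : Prime p) (px≈ε : p · x ≈ ε) (x≉ε : x ≉ ε) where

    prime-order⇒no-shorter-period : ∀ {m} → m ℕ.< p → m · x ≈ ε → m ≡ 0
    prime-order⇒no-shorter-period {zero}  _   _     = refl
    prime-order⇒no-shorter-period {suc _} m<p mx≈ε =
      ⊥-elim (x≉ε (coprime-annihilators⇒≈ε (prime⇒coprime p-prime m<p) px≈ε mx≈ε))

    prime-order⇒·-injective : ∀ {k k'} → k ℕ.< p → k' ℕ.< p → k · x ≈ k' · x → k ≡ k'
    prime-order⇒·-injective {k} {k'} k<p k'<p kx≈k'x with ≤-total k k'
    ... | inj₁ k≤k' = ≤-antisym k≤k' (m∸n≡0⇒m≤n (prime-order⇒no-shorter-period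
                        (≤-<-trans (m∸n≤m k' k) k'<p) (·-difference k≤k' kx≈k'x)))
    ... | inj₂ k'≤k = ≤-antisym (m∸n≡0⇒m≤n (prime-order⇒no-shorter-period
                        (≤-<-trans (m∸n≤m k k') k<p) (·-difference k'≤k (AbelianGroup.sym G kx≈k'x)))) k'≤k

  x∙[y-x]≈y : ∀ x y → x ∙ (y - x) ≈ y
  x∙[y-x]≈y x y = begin
    x ∙ (y - x)        ≈⟨ comm x (y - x) ⟩
    (y ∙ x ⁻¹) ∙ x     ≈⟨ assoc y (x ⁻¹) x ⟩
    y ∙ (x ⁻¹ ∙ x)     ≈⟨ ∙-congˡ (inverseˡ x) ⟩
    y ∙ ε              ≈⟨ identityʳ y ⟩
    y                  ∎

  x∙z-y∙z≈x-y : ∀ x y z → (x ∙ z) - (y ∙ z) ≈ x - y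
  x∙z-y∙z≈x-y x y z = begin
    (x ∙ z) ∙ (y ∙ z) ⁻¹       ≈⟨ ∙-congˡ (⁻¹-∙-comm y z) ⟨
    (x ∙ z) ∙ (y ⁻¹ ∙ z ⁻¹)    ≈⟨ interchange x z (y ⁻¹) (z ⁻¹) ⟩
    (x - y) ∙ (z ∙ z ⁻¹)       ≈⟨ ∙-congˡ (inverseʳ z) ⟩
    (x - y) ∙ ε                ≈⟨ identityʳ (x - y) ⟩
    x - y                      ∎

  w∙x-y≈x-[y-w] : ∀ w x y → (w ∙ x) - y ≈ x - (y - w)
  w∙x-y≈x-[y-w] w x y = begin
    (w ∙ x) ∙ y ⁻¹     ≈⟨ ∙-congʳ (comm w x) ⟩
    (x ∙ w) ∙ y ⁻¹     ≈⟨ assoc x w (y ⁻¹) ⟩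
    x ∙ (w - y)        ≈⟨ ∙-congˡ (⁻¹-anti-homo‿- y w) ⟨
    x ∙ (y - w) ⁻¹     ∎

-- The group ℤ/N

module ℤMod (N : ℕ) .{{N≢0 : NonZero N}} where
  open ModArith N {{N≢0}} public hiding (_-F_)
  open ≡-Reasoning

  toℕ-mod : ∀ m → toℕ (m mod N) ≡ m % N
  toℕ-mod m = toℕ-fromℕ< (m%n<n m N)

  mod-cong : ∀ {m n} → m % N ≡ n % N → m mod N ≡ n mod N
  mod-cong {m} {n} eq = toℕ-injective (trans (toℕ-mod m) (trans eq (sym (toℕ-mod n))))

  toℕ-mod-toℕ : ∀ a → toℕ a mod N ≡ a
  toℕ-mod-toℕ a = toℕ-injective (trans (toℕ-mod (toℕ a)) (m<n⇒m%n≡m (toℕ<n a)))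

  %-cong-+ : ∀ {a a′ b b′} → a % N ≡ a′ % N → b % N ≡ b′ % N → (a + b) % N ≡ (a′ + b′) % N
  %-cong-+ {a} {a′} {b} {b′} a≡a′ b≡b′ = begin
    (a + b) % N               ≡⟨ %-distribˡ-+ a b N ⟩
    (a % N + b % N) % N       ≡⟨ cong₂ (λ m n → (m + n) % N) a≡a′ b≡b′ ⟩
    (a′ % N + b′ % N) % N     ≡⟨ %-distribˡ-+ a′ b′ N ⟨
    (a′ + b′) % N             ∎

  %-congˡ-* : ∀ {a a′} c → a % N ≡ a′ % N → (a * c) % N ≡ (a′ * c) % N
  %-congˡ-* {a} {a′} c a≡a′ = begin
    (a * c) % N               ≡⟨ %-distribˡ-* a c N ⟩
    (a % N * (c % N)) % N     ≡⟨ cong (λ m → (m * (c % N)) % N) a≡a′ ⟩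
    (a′ % N * (c % N)) % N    ≡⟨ %-distribˡ-* a′ c N ⟨
    (a′ * c) % N              ∎

  toℕ-0F : toℕ 0F ≡ 0
  toℕ-0F = trans (toℕ-mod 0) (m<n⇒m%n≡m (>-nonZero⁻¹ N))

  toℕ-+F : ∀ a b → toℕ (a +F b) ≡ (toℕ a + toℕ b) % N
  toℕ-+F a b = toℕ-mod (toℕ a + toℕ b)

  +F-assoc : ∀ a b c → (a +F b) +F c ≡ a +F (b +F c)
  +F-assoc a b c = mod-cong (begin
    (toℕ (a +F b) + toℕ c) % N            ≡⟨ cong (λ k → (k + toℕ c) % N) (toℕ-+F a b) ⟩
    ((toℕ a + toℕ b) % N + toℕ c) % N     ≡⟨ %-cong-+ (m%n%n≡m%n (toℕ a + toℕ b) N) refl ⟩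
    (toℕ a + toℕ b + toℕ c) % N           ≡⟨ cong (_% N) (+-assoc (toℕ a) (toℕ b) (toℕ c)) ⟩
    (toℕ a + (toℕ b + toℕ c)) % N         ≡⟨ %-cong-+ refl (m%n%n≡m%n (toℕ b + toℕ c) N) ⟨
    (toℕ a + (toℕ b + toℕ c) % N) % N     ≡⟨ cong (λ k → (toℕ a + k) % N) (toℕ-+F b c) ⟨
    (toℕ a + toℕ (b +F c)) % N            ∎)

  +F-comm : ∀ a b → a +F b ≡ b +F a
  +F-comm a b = cong (_mod N) (+-comm (toℕ a) (toℕ b))

  +F-identityˡ : ∀ a → 0F +F a ≡ a
  +F-identityˡ a = trans (cong (λ k → (k + toℕ a) mod N) toℕ-0F) (toℕ-mod-toℕ a)

  +F-inverseʳ : ∀ a → a +F (-F a) ≡ 0F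
  +F-inverseʳ a = mod-cong (begin
    (toℕ a + toℕ (-F a)) % N       ≡⟨ cong (λ k → (toℕ a + k) % N) (toℕ-mod (N ∸ toℕ a)) ⟩
    (toℕ a + (N ∸ toℕ a) % N) % N  ≡⟨ %-cong-+ refl (m%n%n≡m%n (N ∸ toℕ a) N) ⟩
    (toℕ a + (N ∸ toℕ a)) % N      ≡⟨ cong (_% N) (m+[n∸m]≡n (<⇒≤ (toℕ<n a))) ⟩
    N % N                          ≡⟨ n%n≡0 N ⟩
    0                              ≡⟨ m<n⇒m%n≡m (>-nonZero⁻¹ N) ⟨
    0 % N                          ∎)

  +F-isAbelianGroup : Structures.IsAbelianGroup _≡_ _+F_ 0F -F_
  +F-isAbelianGroup = isAbelianGroup-≡ +F-assoc +F-comm +F-identityˡ +F-inverseʳ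

  +F-abelianGroup : AbelianGroup 0ℓ 0ℓ
  +F-abelianGroup = record { isAbelianGroup = +F-isAbelianGroup }

  open GroupProperties (AbelianGroup.group +F-abelianGroup) public
    using () renaming (ε⁻¹≈ε to -F0F≡0F)

  -F≡0F⇒≡0F : ∀ {a} → -F a ≡ 0F → a ≡ 0F
  -F≡0F⇒≡0F {a} -a≡0 = trans (sym (⁻¹-involutive a)) (trans (cong -F_ -a≡0) -F0F≡0F)
    where open GroupProperties (AbelianGroup.group +F-abelianGroup) using (⁻¹-involutive)

  open RawMonoidDefinitions (AbelianGroup.rawMonoid +F-abelianGroup) public using () renaming (_×_ to _·F_)

  toℕ-·F : ∀ k a → toℕ (k ·F a) ≡ (k * toℕ a) % N
  toℕ-·F zero    a = trans toℕ-0F (sym (m<n⇒m%n≡m (>-nonZero⁻¹ N)))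
  toℕ-·F (suc k) a = begin
    toℕ (a +F (k ·F a))               ≡⟨ toℕ-+F a (k ·F a) ⟩
    (toℕ a + toℕ (k ·F a)) % N        ≡⟨ cong (λ m → (toℕ a + m) % N) (toℕ-·F k a) ⟩
    (toℕ a + (k * toℕ a) % N) % N     ≡⟨ %-cong-+ refl (m%n%n≡m%n (k * toℕ a) N) ⟩
    (toℕ a + k * toℕ a) % N           ∎

  N·F≡0F : ∀ a → N ·F a ≡ 0F
  N·F≡0F a = toℕ-injective (begin
    toℕ (N ·F a)      ≡⟨ toℕ-·F N a ⟩
    (N * toℕ a) % N   ≡⟨ cong (_% N) (*-comm N (toℕ a)) ⟩
    (toℕ a * N) % N   ≡⟨ m*n%n≡0 (toℕ a) N ⟩
    0                 ≡⟨ toℕ-0F ⟨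
    toℕ 0F            ∎)

module FinCounting (N : ℕ) = Counting Data.Fin._≟_ (allFin N) ∈-allFin (allFin⁺ N)

module ℤModPrimePower (p : ℕ) (p-prime : Prime p) where
  instance
    p≢0 : NonZero p
    p≢0 = prime⇒nonZero p-prime

  module ℤ/p^ (d : ℕ) = ℤMod (p ^ d) {{m^n≢0 p d}}

  p-torsion-divisible : ∀ d a → let open ℤ/p^ (suc d) in p ·F a ≡ 0F → p ^ d ∣ toℕ a
  p-torsion-divisible d a pa≡0 = *-cancelˡ-∣ p (m%n≡0⇒n∣m (p * toℕ a) (p ^ suc d) {{m^n≢0 p (suc d)}}
    (trans (sym (toℕ-·F p a)) (trans (cong toℕ pa≡0) toℕ-0F)))
    where open ℤ/p^ (suc d)

  p-torsion-shape : ∀ d a → let open ℤ/p^ d in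
                    p ·F a ≡ 0F → ∃ λ j → j < p × toℕ a ≡ j * p ^ (d ∸ 1)
  p-torsion-shape zero     a _ = 0 , >-nonZero⁻¹ p , n<1⇒n≡0 (toℕ<n a)
  p-torsion-shape (suc d') a pa≡0 with divides j a≡jq ← p-torsion-divisible d' a pa≡0 =
    j , *-cancelʳ-< (p ^ d') j p (subst (_< p ^ suc d') a≡jq (toℕ<n a)) , a≡jq

  module _ (d : ℕ) where
    open ℤ/p^ d

    p-torsion? : Decidable (λ a → p ·F a ≡ 0F)
    p-torsion? a = p ·F a Data.Fin.≟ 0F

    open FinCounting (p ^ d) using (count; count≤length)

    count-p-torsion≤p : count p-torsion? ≤ p
    count-p-torsion≤p = subst (count p-torsion? ≤_) (length-applyUpTo multiple p)
      (count≤length p-torsion? λ {a} pa≡0 →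
        let j , j<p , a≡jq = p-torsion-shape d a pa≡0 in
        subst (_∈ applyUpTo multiple p) (trans (cong (_mod p ^ d) (sym a≡jq)) (toℕ-mod-toℕ a))
              (∈-applyUpTo⁺ multiple j<p))
      where
      instance _ = m^n≢0 p d
      multiple : ℕ → Fin (p ^ d)
      multiple j = (j * p ^ (d ∸ 1)) mod p ^ d

-- Biadditive forms with values in ℤ/p^d

module AdditiveMap
  {G : Set} {_∙_ : Op₂ G} {ε : G} {_⁻¹ : Op₁ G} (isAbelianGroup : Structures.IsAbelianGroup _≡_ _∙_ ε _⁻¹)
  (N : ℕ) .{{N≢0 : NonZero N}} (f : G → Fin N) (f-∙ : ∀ x y → f (x ∙ y) ≡ ModArith._+F_ N {{N≢0}} (f x) (f y))
  where
  open ℤMod N {{N≢0}}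
  open GroupProperties (AbelianGroup.group +F-abelianGroup) using (identityʳ-unique; inverseʳ-unique)
  open Structures.IsAbelianGroup isAbelianGroup using (identityˡ; inverseʳ)

  private
    abelianGroup : AbelianGroup 0ℓ 0ℓ
    abelianGroup = record { isAbelianGroup = isAbelianGroup }

  open RawMonoidDefinitions (AbelianGroup.rawMonoid abelianGroup) using () renaming (_×_ to _·_)

  f-ε : f ε ≡ 0F
  f-ε = identityʳ-unique (f ε) (f ε) (trans (sym (f-∙ ε ε)) (cong f (identityˡ ε)))

  f-⁻¹ : ∀ x → f (x ⁻¹) ≡ -F f x
  f-⁻¹ x = inverseʳ-unique (f x) (f (x ⁻¹)) (trans (sym (f-∙ x (x ⁻¹))) (trans (cong f (inverseʳ x)) f-ε))

  f-· : ∀ n x → f (n · x) ≡ n ·F f x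
  f-· zero    x = f-ε
  f-· (suc n) x = trans (f-∙ x (n · x)) (cong (f x +F_) (f-· n x))

module Pairings
  {G : Set} {_∙_ : Op₂ G} {ε : G} {_⁻¹ : Op₁ G} (isAbelianGroup : Structures.IsAbelianGroup _≡_ _∙_ ε _⁻¹)
  (_≟_ : DecidableEquality G) (elems : List G) (∈-elems : ∀ x → x ∈ elems) (elems! : Unique elems)
  (p : ℕ) (p-prime : Prime p) (d : ℕ)
  where

  open ℤModPrimePower p p-prime using (module ℤ/p^; p-torsion?; count-p-torsion≤p)
  open ℤ/p^ d
  open import Data.List.Membership.DecPropositional _≟_ using (_∈?_)

  private instance
    p^d≢0 : NonZero (p ^ d)
    p^d≢0 = m^n≢0 p d {{prime⇒nonZero p-prime}}

  record IsDecSubgroup (A : Pred G 0ℓ) : Set where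
    field
      dec : Decidable A
      ε∈  : A ε
      ∙∈  : ∀ {x y} → A x → A y → A (x ∙ y)
      ⁻¹∈ : ∀ {x} → A x → A (x ⁻¹)

  open IsDecSubgroup

  module BiadditiveForm (B : G → G → Fin (p ^ d))
                        (B-∙ˡ : ∀ x y z → B (x ∙ y) z ≡ B x z +F B y z)
                        (B-∙ʳ : ∀ x y z → B x (y ∙ z) ≡ B x y +F B x z) where

    open FinCounting (p ^ d) using () renaming (listOf to listOfᴿ; count to countᴿ; ∈-listOf⁺ to ∈-listOfᴿ⁺)
    open Counting _≟_ elems ∈-elems elems!
    private
      abelianGroup : AbelianGroup 0ℓ 0ℓ
      abelianGroup = record { isAbelianGroup = isAbelianGroup }
    open GroupProperties (AbelianGroup.group abelianGroup) using (∙-cancelʳ)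
    open RawMonoidDefinitions (AbelianGroup.rawMonoid abelianGroup) using () renaming (_×_ to _·_)
    open MonoidMultProperties (AbelianGroup.monoid abelianGroup) using (×-homo-1; ×-assocˡ)
    module Bˡ t = AdditiveMap isAbelianGroup (p ^ d) (λ a → B a t) (λ x y → B-∙ˡ x y t)
    module Bʳ a = AdditiveMap isAbelianGroup (p ^ d) (B a) (B-∙ʳ a)


    _⊥ : Pred G 0ℓ → Pred G 0ℓ
    (A ⊥) t = ∀ a → A a → B a t ≡ 0F

    ⊥? : ∀ {A} → Decidable A → Decidable (A ⊥)
    ⊥? A? t = ∀? (λ a → A? a →-dec (B a t Data.Fin.≟ 0F))

    ⊥-isDecSubgroup : ∀ {A} → Decidable A → IsDecSubgroup (A ⊥)
    ⊥-isDecSubgroup {A} A? = record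
      { dec = ⊥? A?
      ; ε∈  = λ a _ → Bʳ.f-ε a
      ; ∙∈  = λ {x} {y} x∈ y∈ a Aa → trans (B-∙ʳ a x y) (trans (cong₂ _+F_ (x∈ a Aa) (y∈ a Aa)) (+F-identityˡ 0F))
      ; ⁻¹∈ = λ {x} x∈ a Aa → trans (Bʳ.f-⁻¹ a x) (trans (cong -F_ (x∈ a Aa)) -F0F≡0F)
      }

    ∃-separating : ∀ {X} (X? : Decidable X) {t} → ¬ (X ⊥) t → ∃ λ x → X x × B x t ≢ 0F
    ∃-separating X? {t} t∉X⊥ with ∃? (λ x → X? x ×-dec ¬? (B x t Data.Fin.≟ 0F))
    ... | yes sep = sep
    ... | no ∄sep = ⊥-elim (t∉X⊥ λ x Xx → decidable-stable (B x t Data.Fin.≟ 0F) (λ ≢0 → ∄sep (x , Xx , ≢0)))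

    module _ {A : Pred G 0ℓ} (A-sub : IsDecSubgroup A) where
      private A? = dec A-sub

      module _ (φ : G → Fin (p ^ d)) (φ-∙ : ∀ x y → φ (x ∙ y) ≡ φ x +F φ y) where
        private module φ = AdditiveMap isAbelianGroup (p ^ d) φ φ-∙

        kernel : Pred G 0ℓ
        kernel a = A a × φ a ≡ 0F

        kernel-isDecSubgroup : IsDecSubgroup kernel
        kernel-isDecSubgroup = record
          { dec = λ a → A? a ×-dec (φ a Data.Fin.≟ 0F)
          ; ε∈  = ε∈ A-sub , φ.f-ε
          ; ∙∈  = λ {x} {y} (Ax , φx) (Ay , φy) →
                    ∙∈ A-sub Ax Ay , trans (φ-∙ x y) (trans (cong₂ _+F_ φx φy) (+F-identityˡ 0F))
          ; ⁻¹∈ = λ {x} (Ax , φx) → ⁻¹∈ A-sub Ax , trans (φ.f-⁻¹ x) (trans (cong -F_ φx) -F0F≡0F)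
          }

        private kernel? = dec kernel-isDecSubgroup

        -- a ↦ (φ a , a − ρ (φ a)) is injective, where ρ picks one preimage in A of each value
        count≤count-image*count-kernel : ∀ {S} (S? : Decidable S) → (∀ {a} → A a → S (φ a)) →
                                         count A? ≤ countᴿ S? * count kernel?
        count≤count-image*count-kernel S? φ[A]⊆S = begin
          count A?                                                 ≡⟨ length-map split (listOf A?) ⟨
          length (map split (listOf A?))                           ≤⟨ unique-⊆⇒length≤ (map⁺ split-injective (listOf! A?)) split-∈ ⟩
          length (cartesianProduct (listOfᴿ S?) (listOf kernel?))  ≡⟨ length-cartesianProductWith _,_ (listOfᴿ S?) (listOf kernel?) ⟩
          countᴿ S? * count kernel?                                ∎
          where
          open ≤-Reasoning
          ρ : Fin (p ^ d) → G
          ρ v = fromMaybe ε (head (filter (λ b → φ b Data.Fin.≟ v) (listOf A?)))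

          ρ-preimage : ∀ {a} → A a → A (ρ (φ a)) × φ (ρ (φ a)) ≡ φ a
          ρ-preimage {a} Aa =
            let ρ∈ , φρ≡φa = ∈-filter⁻ (λ b → φ b Data.Fin.≟ φ a) {xs = listOf A?}
                               (∈⇒head∈ (∈-filter⁺ (λ b → φ b Data.Fin.≟ φ a) (∈-listOf⁺ A? Aa) refl))
            in ∈-listOf⁻ A? ρ∈ , φρ≡φa

          split : G → Fin (p ^ d) × G
          split a = φ a , a ∙ (ρ (φ a) ⁻¹)

          split-injective : ∀ {a b} → split a ≡ split b → a ≡ b
          split-injective {a} {b} eq = ∙-cancelʳ (ρ (φ a) ⁻¹) a b
            (trans (cong proj₂ eq) (cong (λ v → b ∙ (ρ v ⁻¹)) (sym (cong proj₁ eq))))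

          split-∈ : map split (listOf A?) ⊆ cartesianProduct (listOfᴿ S?) (listOf kernel?)
          split-∈ m with a , a∈ , refl ← ∈-map⁻ split m =
            let Aa = ∈-listOf⁻ A? a∈
                Aρ , φρ≡φa = ρ-preimage Aa
            in ∈-cartesianProduct⁺ (∈-listOfᴿ⁺ S? (φ[A]⊆S Aa)) (∈-listOf⁺ kernel?
                 (∙∈ A-sub Aa (⁻¹∈ A-sub Aρ) ,
                  trans (φ-∙ a _) (trans (cong (φ a +F_) (trans (φ.f-⁻¹ _) (cong -F_ φρ≡φa))) (+F-inverseʳ (φ a)))))

      -- t = p ^ j · t₀ for the largest j such that B (A , p ^ j · t₀) ≠ 0
      ∃-functional-of-order-p : ∀ {a* t₀} → A a* → B a* t₀ ≢ 0F →
        ∃ λ t → (∃ λ a₀ → A a₀ × B a₀ t ≢ 0F) × (∀ {a} → A a → p ·F B a t ≡ 0F)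
      ∃-functional-of-order-p {a*} {t₀} Aa* Ba*t₀≢0 =
        let j , Pj , ¬Pj+1 = ∃-boundary P? P0 {d} ¬Pd in (p ^ j) · t₀ , Pj , killed j ¬Pj+1
        where
        P : Pred ℕ 0ℓ
        P j = ∃ λ a → A a × B a ((p ^ j) · t₀) ≢ 0F

        P? : Decidable P
        P? j = ∃? (λ a → A? a ×-dec ¬? (B a ((p ^ j) · t₀) Data.Fin.≟ 0F))

        P0 : P 0
        P0 = a* , Aa* , Ba*t₀≢0 ∘ trans (cong (B a*) (sym (×-homo-1 t₀)))

        ¬Pd : ¬ P d
        ¬Pd (a , _ , ≢0) = ≢0 (trans (Bʳ.f-· a (p ^ d) t₀) (N·F≡0F (B a t₀)))

        killed : ∀ j → ¬ P (suc j) → ∀ {a} → A a → p ·F B a ((p ^ j) · t₀) ≡ 0F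
        killed j ¬Pj+1 {a} Aa = begin
          p ·F B a ((p ^ j) · t₀)     ≡⟨ Bʳ.f-· a p ((p ^ j) · t₀) ⟨
          B a (p · ((p ^ j) · t₀))    ≡⟨ cong (B a) (×-assocˡ t₀ p (p ^ j)) ⟩
          B a ((p ^ suc j) · t₀)      ≡⟨ decidable-stable (B a _ Data.Fin.≟ 0F) (λ ≢0 → ¬Pj+1 (a , Aa , ≢0)) ⟩
          0F                          ∎
          where open ≡-Reasoning

      module _ {t₁ a₀ : G} (Aa₀ : A a₀) (c≢0 : B a₀ t₁ ≢ 0F) (pc≡0 : p ·F B a₀ t₁ ≡ 0F) where
        private
          A′ = kernel (λ a → B a t₁) (λ x y → B-∙ˡ x y t₁)
          A′-sub = kernel-isDecSubgroup (λ a → B a t₁) (λ x y → B-∙ˡ x y t₁)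
          A′? = dec A′-sub

        count-kernel<count : count A′? < count A?
        count-kernel<count = count-mono-< A′? A? proj₁ Aa₀ (c≢0 ∘ proj₂)

        -- the translates s + k t₁ (k < p) of A⊥ are distinct, as B a₀ separates them
        p*count⊥≤count-kernel⊥ : p * count (⊥? A?) ≤ count (⊥? A′?)
        p*count⊥≤count-kernel⊥ = begin
          p * count (⊥? A?)                ≡⟨ cong (_* count (⊥? A?)) (length-upTo p) ⟨
          length (upTo p) * count (⊥? A?)  ≡⟨ length-cartesianProductWith _,_ (upTo p) (listOf (⊥? A?)) ⟨
          length L                         ≡⟨ length-map shift L ⟨
          length (map shift L)             ≤⟨ length≤count (⊥? A′?) (map⁺-injectiveOn shift L! shift-injective) shift-∈ ⟩
          count (⊥? A′?)                   ∎
          where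
          open ≤-Reasoning
          L : List (ℕ × G)
          L = cartesianProduct (upTo p) (listOf (⊥? A?))
          L! : Unique L
          L! = cartesianProduct⁺ (upTo⁺ p) (listOf! (⊥? A?))

          shift : ℕ × G → G
          shift (k , s) = s ∙ (k · t₁)

          B-a₀-shift : ∀ {k s} → (A ⊥) s → B a₀ (shift (k , s)) ≡ k ·F B a₀ t₁
          B-a₀-shift {k} {s} s⊥A = trans (B-∙ʳ a₀ s (k · t₁))
            (trans (cong₂ _+F_ (s⊥A a₀ Aa₀) (Bʳ.f-· a₀ k t₁)) (+F-identityˡ _))

          shift-injective : ∀ {x y} → x ∈ L → y ∈ L → shift x ≡ shift y → x ≡ y
          shift-injective {k , s} {k′ , s′} x∈L y∈L eq =
            let k<p , s∈ = ∈-cartesianProduct⁻ (upTo p) (listOf (⊥? A?)) x∈L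
                k′<p , s′∈ = ∈-cartesianProduct⁻ (upTo p) (listOf (⊥? A?)) y∈L
                k≡k′ = prime-order⇒·-injective +F-abelianGroup p-prime pc≡0 c≢0 (∈-upTo⁻ k<p) (∈-upTo⁻ k′<p)
                         (trans (sym (B-a₀-shift {k} (∈-listOf⁻ (⊥? A?) s∈)))
                                (trans (cong (B a₀) eq) (B-a₀-shift {k′} (∈-listOf⁻ (⊥? A?) s′∈))))
            in cong₂ _,_ k≡k′ (∙-cancelʳ (k · t₁) s s′ (trans eq (cong (λ i → s′ ∙ (i · t₁)) (sym k≡k′))))

          shift-∈ : ∀ {x} → x ∈ map shift L → (A′ ⊥) x
          shift-∈ x∈ with (k , s) , ks∈L , refl ← ∈-map⁻ shift x∈ = λ a (Aa , Bat₁≡0) →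
            let s⊥A = ∈-listOf⁻ (⊥? A?) (proj₂ (∈-cartesianProduct⁻ (upTo p) (listOf (⊥? A?)) ks∈L)) in
            trans (B-∙ʳ a s (k · t₁))
              (trans (cong₂ _+F_ (s⊥A a Aa) (trans (Bʳ.f-· a k t₁) (cong (k ·F_) Bat₁≡0)))
                (trans (+F-identityˡ (k ·F 0F)) (·-zeroʳ +F-abelianGroup k)))

    LeftNondegenerate : Set
    LeftNondegenerate = ∀ a → a ≢ ε → ∃ λ t → B a t ≢ 0F

    module _ (nondegenerate : LeftNondegenerate) where
      open ≤-Reasoning

      private
        count*count⊥≤-step : ∀ {A} (A-sub : IsDecSubgroup A) {a*} → A a* → a* ≢ ε →
          let A? = dec A-sub in
          (∀ {A′} (A′-sub : IsDecSubgroup A′) → count (dec A′-sub) < count A? →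
             count (dec A′-sub) * count (⊥? (dec A′-sub)) ≤ length elems) →
          count A? * count (⊥? A?) ≤ length elems
        count*count⊥≤-step {A} A-sub Aa* a*≢ε IH =
          let A? = dec A-sub
              t₀ , Ba*t₀≢0 = nondegenerate _ a*≢ε
              t₁ , (a₀ , Aa₀ , c≢0) , p·B[A,t₁]≡0 = ∃-functional-of-order-p A-sub Aa* Ba*t₀≢0
              A′-sub = kernel-isDecSubgroup A-sub (λ a → B a t₁) (λ x y → B-∙ˡ x y t₁)
              A′? = dec A′-sub
          in begin
          count A? * count (⊥? A?)
            ≤⟨ *-monoˡ-≤ (count (⊥? A?)) (≤-trans
                 (count≤count-image*count-kernel A-sub (λ a → B a t₁) (λ x y → B-∙ˡ x y t₁) (p-torsion? d) p·B[A,t₁]≡0)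
                 (*-monoˡ-≤ (count A′?) (count-p-torsion≤p d))) ⟩
          p * count A′? * count (⊥? A?)    ≡⟨ cong (_* count (⊥? A?)) (*-comm p (count A′?)) ⟩
          count A′? * p * count (⊥? A?)    ≡⟨ *-assoc (count A′?) p (count (⊥? A?)) ⟩
          count A′? * (p * count (⊥? A?))
            ≤⟨ *-monoʳ-≤ (count A′?) (p*count⊥≤count-kernel⊥ A-sub Aa₀ c≢0 (p·B[A,t₁]≡0 Aa₀)) ⟩
          count A′? * count (⊥? A′?)       ≤⟨ IH A′-sub (count-kernel<count A-sub Aa₀ c≢0 (p·B[A,t₁]≡0 Aa₀)) ⟩
          length elems                     ∎

        count*count⊥≤-trivial : ∀ {A} (A-sub : IsDecSubgroup A) → (∀ {a} → A a → a ≡ ε) →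
          count (dec A-sub) * count (⊥? (dec A-sub)) ≤ length elems
        count*count⊥≤-trivial A-sub A≡ε = begin
          count A? * count (⊥? A?)  ≤⟨ *-monoˡ-≤ _ (count≤length A? {ys = ε ∷ []} (here ∘ A≡ε)) ⟩
          1 * count (⊥? A?)         ≡⟨ *-identityˡ _ ⟩
          count (⊥? A?)             ≤⟨ count≤length (⊥? A?) (λ {x} _ → ∈-elems x) ⟩
          length elems              ∎
          where A? = dec A-sub

        count*count⊥≤-bounded : ∀ n {A} (A-sub : IsDecSubgroup A) → count (dec A-sub) < n →
          count (dec A-sub) * count (⊥? (dec A-sub)) ≤ length elems
        count*count⊥≤-bounded (suc n) A-sub A<1+n with ∃? (λ a → dec A-sub a ×-dec ¬? (a ≟ ε))
        ... | yes (a* , Aa* , a*≢ε) = count*count⊥≤-step A-sub Aa* a*≢ε λ A′-sub A′<A →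
                                        count*count⊥≤-bounded n A′-sub (<-≤-trans A′<A (s≤s⁻¹ A<1+n))
        ... | no ∄a≢ε = count*count⊥≤-trivial A-sub λ {a} Aa →
                          decidable-stable (a ≟ ε) (λ a≢ε → ∄a≢ε (a , Aa , a≢ε))

      count*count⊥≤|G| : ∀ {A} (A-sub : IsDecSubgroup A) →
                           count (dec A-sub) * count (⊥? (dec A-sub)) ≤ length elems
      count*count⊥≤|G| A-sub = count*count⊥≤-bounded _ A-sub ≤-refl

      ⊥⊆-by-count : ∀ {X Y} (X-sub : IsDecSubgroup X) (Y? : Decidable Y) → (∀ {y} → Y y → (X ⊥) y) →
                    length elems ≤ count (dec X-sub) * count Y? → ∀ {t} → (X ⊥) t → Y t
      ⊥⊆-by-count X-sub Y? Y⊆X⊥ |G|≤|X||Y| =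
        count≤⇒⊇ Y? (⊥? (dec X-sub)) Y⊆X⊥
          (*-cancelˡ-≤ (count (dec X-sub)) {{>-nonZero (∈-length (∈-listOf⁺ (dec X-sub) (ε∈ X-sub)))}}
            (≤-trans (count*count⊥≤|G| X-sub) |G|≤|X||Y|))

    Isotropic : List G → Set
    Isotropic W = ∀ {x y} → x ∈ W → y ∈ W → B x y ≡ 0F

    module Reflexive (reflexive : ∀ {x y} → B x y ≡ 0F → B y x ≡ 0F) (nondegenerate : LeftNondegenerate)
                     {n} (|G|≡n*n : length elems ≡ n * n) {W} (W! : Unique W) (W-iso : Isotropic W) where
      private W? = _∈? W

      closure : Pred G 0ℓ
      closure = ((_∈ W) ⊥) ⊥

      closure-isDecSubgroup : IsDecSubgroup closure
      closure-isDecSubgroup = ⊥-isDecSubgroup (⊥? W?)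

      private closure? = dec closure-isDecSubgroup

      ⊆closure : ∀ {w} → w ∈ W → closure w
      ⊆closure w∈W a a⊥W = reflexive (a⊥W _ w∈W)

      closure-isotropic : ∀ {c} → closure c → (closure ⊥) c
      closure-isotropic c∈ c′ c′∈ = c∈ c′ λ w w∈W → c′∈ w λ w′ w′∈W → W-iso w′∈W w∈W

      count-closure≤n : count closure? ≤ n
      count-closure≤n = m*m≤n*n⇒m≤n (begin
        count closure? * count closure?
          ≤⟨ *-monoʳ-≤ (count closure?) (count-mono closure? (⊥? closure?) closure-isotropic) ⟩
        count closure? * count (⊥? closure?)     ≤⟨ count*count⊥≤|G| nondegenerate closure-isDecSubgroup ⟩
        length elems                             ≡⟨ |G|≡n*n ⟩
        n * n                                    ∎)
        where open ≤-Reasoning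

      length≤n : length W ≤ n
      length≤n = ≤-trans (length≤count closure? W! ⊆closure) count-closure≤n

      module _ (|W|≡n : length W ≡ n) where

        closure⊆ : ∀ {x} → closure x → x ∈ W
        closure⊆ = count≤length⇒⊆ closure? W! ⊆closure (subst (count closure? ≤_) (sym |W|≡n) count-closure≤n)

        count-closure≡n : count closure? ≡ n
        count-closure≡n = ≤-antisym count-closure≤n (subst (_≤ count closure?) |W|≡n (length≤count closure? W! ⊆closure))

        ∉⇒separated : ∀ {g} → g ∉ W → ∃ λ c → closure c × B c g ≢ 0F
        ∉⇒separated g∉W = ∃-separating closure? λ g∈closure⊥ →
          g∉W (closure⊆ (⊥⊆-by-count nondegenerate closure-isDecSubgroup closure? closure-isotropic
            (≤-reflexive (trans |G|≡n*n (sym (cong₂ _*_ count-closure≡n count-closure≡n)))) g∈closure⊥))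

-- The group G = ∏ ℤ/p^dᵢ and its pairing

module FiniteAbelianPGroup (p : ℕ) (p-prime : Prime p) where
  open Setup p {{prime⇒nonZero p-prime}} hiding (_-G_)
  open ℤModPrimePower p p-prime using (module ℤ/p^; p≢0)

  +G-assoc : ∀ {ds} (x y z : GElt ds) → (x +G y) +G z ≡ x +G (y +G z)
  +G-assoc []                 []       []       = refl
  +G-assoc (_∷_ {e} x xs) (y ∷ ys) (z ∷ zs) = cong₂ _∷_ (ℤ/p^.+F-assoc e x y z) (+G-assoc xs ys zs)

  +G-comm : ∀ {ds} (x y : GElt ds) → x +G y ≡ y +G x
  +G-comm []             []       = refl
  +G-comm (_∷_ {e} x xs) (y ∷ ys) = cong₂ _∷_ (ℤ/p^.+F-comm e x y) (+G-comm xs ys)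

  +G-identityˡ : ∀ {ds} (x : GElt ds) → 0G ds +G x ≡ x
  +G-identityˡ []             = refl
  +G-identityˡ (_∷_ {e} x xs) = cong₂ _∷_ (ℤ/p^.+F-identityˡ e x) (+G-identityˡ xs)

  +G-inverseʳ : ∀ {ds} (x : GElt ds) → x +G (-G x) ≡ 0G ds
  +G-inverseʳ []             = refl
  +G-inverseʳ (_∷_ {e} x xs) = cong₂ _∷_ (ℤ/p^.+F-inverseʳ e x) (+G-inverseʳ xs)

  +G-isAbelianGroup : ∀ ds → Structures.IsAbelianGroup _≡_ (_+G_ {ds}) (0G ds) -G_
  +G-isAbelianGroup ds = isAbelianGroup-≡ +G-assoc +G-comm +G-identityˡ +G-inverseʳ

  _≟G_ : ∀ {ds} → DecidableEquality (GElt ds)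
  []       ≟G []       = yes refl
  (x ∷ xs) ≟G (y ∷ ys) with x Data.Fin.≟ y | xs ≟G ys
  ... | yes refl | yes refl = yes refl
  ... | no x≢y   | _        = no λ { refl → x≢y refl }
  ... | _        | no xs≢ys = no λ { refl → xs≢ys refl }

  elemsG : ∀ ds → List (GElt ds)
  elemsG []       = [] ∷ []
  elemsG (e ∷ es) = cartesianProductWith _∷_ (allFin (p ^ e)) (elemsG es)

  ∈-elemsG : ∀ {ds} (x : GElt ds) → x ∈ elemsG ds
  ∈-elemsG []       = here refl
  ∈-elemsG (x ∷ xs) = ∈-cartesianProductWith⁺ _∷_ (∈-allFin x) (∈-elemsG xs)

  elemsG! : ∀ ds → Unique (elemsG ds)
  elemsG! []       = [] ∷ []
  elemsG! (e ∷ es) = cartesianProductWith⁺ _∷_ (λ { refl → refl , refl }) (allFin⁺ (p ^ e)) (elemsG! es)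

  length-elemsG : ∀ ds → length (elemsG ds) ≡ card ds
  length-elemsG []       = refl
  length-elemsG (e ∷ es) = trans (length-cartesianProductWith _∷_ (allFin (p ^ e)) (elemsG es))
                             (cong₂ _*_ (length-tabulate {n = p ^ e} id) (length-elemsG es))

  module _ {ds : List ℕ} where
    open Definitions {A = G² ds} _≡_ using (Associative; Commutative; LeftIdentity; RightInverse)

    +²-assoc : Associative _+²_
    +²-assoc (g , h) (g′ , h′) (g″ , h″) = cong₂ _,_ (+G-assoc g g′ g″) (+G-assoc h h′ h″)

    +²-comm : Commutative _+²_
    +²-comm (g , h) (g′ , h′) = cong₂ _,_ (+G-comm g g′) (+G-comm h h′)

    +²-identityˡ : LeftIdentity (0² ds) _+²_
    +²-identityˡ (g , h) = cong₂ _,_ (+G-identityˡ g) (+G-identityˡ h)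

    +²-inverseʳ : RightInverse (0² ds) -²_ _+²_
    +²-inverseʳ (g , h) = cong₂ _,_ (+G-inverseʳ g) (+G-inverseʳ h)

  +²-isAbelianGroup : ∀ ds → Structures.IsAbelianGroup _≡_ (_+²_ {ds}) (0² ds) -²_
  +²-isAbelianGroup ds = isAbelianGroup-≡ +²-assoc +²-comm +²-identityˡ +²-inverseʳ

  _≟²_ : ∀ {ds} → DecidableEquality (G² ds)
  _≟²_ = ≡-dec _≟G_ _≟G_

  elems² : ∀ ds → List (G² ds)
  elems² ds = cartesianProduct (elemsG ds) (elemsG ds)

  ∈-elems² : ∀ {ds} (x : G² ds) → x ∈ elems² ds
  ∈-elems² (g , h) = ∈-cartesianProduct⁺ (∈-elemsG g) (∈-elemsG h)

  elems²! : ∀ ds → Unique (elems² ds)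
  elems²! ds = cartesianProduct⁺ (elemsG! ds) (elemsG! ds)

  length-elems² : ∀ ds → length (elems² ds) ≡ card ds * card ds
  length-elems² ds = trans (length-cartesianProductWith _,_ (elemsG ds) (elemsG ds))
                           (cong₂ _*_ (length-elemsG ds) (length-elemsG ds))

  module DotProduct (d : ℕ) where
    open ℤ/p^ d
    private instance
      p^d≢0 : NonZero (p ^ d)
      p^d≢0 = m^n≢0 p d
    open ≡-Reasoning

    scaled-mod : ∀ {e} → e ≤ d → ∀ m → let instance _ = m^n≢0 p e in
                 p ^ (d ∸ e) * (m % p ^ e) ≡ (p ^ (d ∸ e) * m) % p ^ d
    scaled-mod {e} e≤d m = begin
      p ^ (d ∸ e) * (m % p ^ e)                ≡⟨ *-comm (p ^ (d ∸ e)) (m % p ^ e) ⟩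
      m % p ^ e * p ^ (d ∸ e)                  ≡⟨ m%n*o≡m*o%[n*o] m (p ^ e) (p ^ (d ∸ e)) ⟩
      m * p ^ (d ∸ e) % (p ^ e * p ^ (d ∸ e))  ≡⟨ %-congʳ p^e*p^[d∸e]≡p^d ⟩
      m * p ^ (d ∸ e) % p ^ d                  ≡⟨ cong (_% p ^ d) (*-comm m (p ^ (d ∸ e))) ⟩
      p ^ (d ∸ e) * m % p ^ d                  ∎
      where
      instance
        p^e≢0 = m^n≢0 p e
        p^[d∸e]≢0 = m^n≢0 p (d ∸ e)
        p^e*p^[d∸e]≢0 = m*n≢0 (p ^ e) (p ^ (d ∸ e))
      p^e*p^[d∸e]≡p^d : p ^ e * p ^ (d ∸ e) ≡ p ^ d
      p^e*p^[d∸e]≡p^d = trans (sym (^-distribˡ-+-* p e (d ∸ e))) (cong (p ^_) (m+[n∸m]≡n e≤d))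

    dotℕ-+ˡ : ∀ {ds} → All (_≤ d) ds → (x y z : GElt ds) →
              dotℕ d (x +G y) z % p ^ d ≡ (dotℕ d x z + dotℕ d y z) % p ^ d
    dotℕ-+ˡ []           []             []       []       = refl
    dotℕ-+ˡ (e≤d ∷ ds≤d) (_∷_ {e} x xs) (y ∷ ys) (z ∷ zs) = begin
      (k * toℕ (ℤ/p^._+F_ e x y) * toℕ z + dotℕ d (xs +G ys) zs) % p ^ d
        ≡⟨ %-cong-+ (%-congˡ-* (toℕ z) head-+) (dotℕ-+ˡ ds≤d xs ys zs) ⟩
      (k * (toℕ x + toℕ y) * toℕ z + (dotℕ d xs zs + dotℕ d ys zs)) % p ^ d
        ≡⟨ cong (_% p ^ d) (rearrange k (toℕ x) (toℕ y) (toℕ z) (dotℕ d xs zs) (dotℕ d ys zs)) ⟩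
      (k * toℕ x * toℕ z + dotℕ d xs zs + (k * toℕ y * toℕ z + dotℕ d ys zs)) % p ^ d ∎
      where
      k = p ^ (d ∸ e)
      rearrange : ∀ k a b c u v → k * (a + b) * c + (u + v) ≡ k * a * c + u + (k * b * c + v)
      rearrange = solve-∀
      head-+ : (k * toℕ (ℤ/p^._+F_ e x y)) % p ^ d ≡ (k * (toℕ x + toℕ y)) % p ^ d
      head-+ = begin
        (k * toℕ (ℤ/p^._+F_ e x y)) % p ^ d          ≡⟨ cong (λ m → (k * m) % p ^ d) (ℤ/p^.toℕ-+F e x y) ⟩
        (k * ((toℕ x + toℕ y) % p ^ e)) % p ^ d      ≡⟨ cong (_% p ^ d) (scaled-mod e≤d (toℕ x + toℕ y)) ⟩
        (k * (toℕ x + toℕ y)) % p ^ d % p ^ d        ≡⟨ m%n%n≡m%n (k * (toℕ x + toℕ y)) (p ^ d) ⟩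
        (k * (toℕ x + toℕ y)) % p ^ d                ∎
        where instance _ = m^n≢0 p e

    dot-+ˡ : ∀ {ds} → All (_≤ d) ds → (x y z : GElt ds) → dot d (x +G y) z ≡ dot d x z +F dot d y z
    dot-+ˡ ds≤d x y z = mod-cong (begin
      dotℕ d (x +G y) z % p ^ d                                   ≡⟨ dotℕ-+ˡ ds≤d x y z ⟩
      (dotℕ d x z + dotℕ d y z) % p ^ d                           ≡⟨ %-distribˡ-+ (dotℕ d x z) (dotℕ d y z) (p ^ d) ⟩
      (dotℕ d x z % p ^ d + dotℕ d y z % p ^ d) % p ^ d           ≡⟨ cong₂ (λ m n → (m + n) % p ^ d) (toℕ-mod _) (toℕ-mod _) ⟨
      (toℕ (dot d x z) + toℕ (dot d y z)) % p ^ d                 ∎)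

    dotℕ-comm : ∀ {ds} (x y : GElt ds) → dotℕ d x y ≡ dotℕ d y x
    dotℕ-comm []             []       = refl
    dotℕ-comm (_∷_ {e} x xs) (y ∷ ys) = cong₂ _+_ (swap (p ^ (d ∸ e)) (toℕ x) (toℕ y)) (dotℕ-comm xs ys)
      where
      swap : ∀ k a b → k * a * b ≡ k * b * a
      swap = solve-∀

    dot-comm : ∀ {ds} (x y : GElt ds) → dot d x y ≡ dot d y x
    dot-comm x y = cong (_mod p ^ d) (dotℕ-comm x y)

    dot-+ʳ : ∀ {ds} → All (_≤ d) ds → (x y z : GElt ds) → dot d x (y +G z) ≡ dot d x y +F dot d x z
    dot-+ʳ ds≤d x y z = trans (dot-comm x (y +G z))
      (trans (dot-+ˡ ds≤d y z x) (cong₂ _+F_ (dot-comm y x) (dot-comm z x)))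

    dotℕ-0∷ʳ : ∀ {e es} (x : Fin (p ^ e)) (xs : GElt es) y → dotℕ d (_∷_ {e} x xs) (ℤ/p^.0F e ∷ y) ≡ dotℕ d xs y
    dotℕ-0∷ʳ {e} x xs y =
      cong (_+ dotℕ d xs y) (trans (cong (p ^ (d ∸ e) * toℕ x *_) (ℤ/p^.toℕ-0F e)) (*-zeroʳ (p ^ (d ∸ e) * toℕ x)))

    dotℕ-0ʳ : ∀ {ds} (x : GElt ds) → dotℕ d x (0G ds) ≡ 0
    dotℕ-0ʳ []                 = refl
    dotℕ-0ʳ (_∷_ {e} {es} x xs) = trans (dotℕ-0∷ʳ {e} x xs (0G es)) (dotℕ-0ʳ xs)

    -- pair x against the first coordinate vector on which it is non-zero
    dot-nondegenerate : ∀ {ds} → All (_≤ d) ds → (x : GElt ds) → x ≢ 0G ds → ∃ λ y → dot d x y ≢ 0F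
    dot-nondegenerate []           []                  []≢[] = ⊥-elim ([]≢[] refl)
    dot-nondegenerate (e≤d ∷ ds≤d) (_∷_ {e} {es} x xs) x∷xs≢0 with toℕ x ℕ.≟ 0
    ... | yes x≡0 =
      let y , xs·y≢0 = dot-nondegenerate ds≤d xs
                         (x∷xs≢0 ∘ cong₂ _∷_ (toℕ-injective (trans x≡0 (sym (ℤ/p^.toℕ-0F e)))))
      in _∷_ {e} (ℤ/p^.0F e) y , xs·y≢0 ∘ trans (cong (_mod p ^ d) (sym (dotℕ-0∷ʳ {e} x xs y)))
    ... | no x≢0 = basis , λ x·basis≡0 →
      x≢0 (m*n≡0⇒m≡0 (toℕ x) k (trans (*-comm (toℕ x) k) (trans k*x≡x·basis (trans (cong toℕ x·basis≡0) toℕ-0F))))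
      where
      instance
        p^e≢0 = m^n≢0 p e
        k≢0 = m^n≢0 p (d ∸ e)
      k = p ^ (d ∸ e)
      one : Fin (p ^ e)
      one = 1 mod p ^ e
      basis : GElt (e ∷ es)
      basis = one ∷ 0G es
      toℕ-one : toℕ one ≡ 1
      toℕ-one = trans (ℤ/p^.toℕ-mod e 1) (m<n⇒m%n≡m (≤-<-trans (n≢0⇒n>0 x≢0) (toℕ<n x)))
      k*x≡x·basis : k * toℕ x ≡ toℕ (dot d (x ∷ xs) basis)
      k*x≡x·basis = begin
        k * toℕ x                          ≡⟨ cong (k *_) (m<n⇒m%n≡m (toℕ<n x)) ⟨
        k * (toℕ x % p ^ e)                ≡⟨ scaled-mod e≤d (toℕ x) ⟩
        (k * toℕ x) % p ^ d                ≡⟨ cong (_% p ^ d) (trans (cong₂ _+_ (cong (k * toℕ x *_) toℕ-one) (dotℕ-0ʳ xs))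
                                                                  (trans (+-identityʳ _) (*-identityʳ _))) ⟨
        dotℕ d (x ∷ xs) basis % p ^ d      ≡⟨ toℕ-mod _ ⟨
        toℕ (dot d (x ∷ xs) basis)         ∎

-- The four forms on G²

module Cases (p : ℕ) (p-prime : Prime p) (d : ℕ) (ds : List ℕ) (ds≤d : All (_≤ d) ds) where
  open Setup p {{prime⇒nonZero p-prime}} hiding (_-G_)
  open FiniteAbelianPGroup p p-prime
  open DotProduct d
  open ℤModPrimePower p p-prime using (module ℤ/p^)
  open ℤ/p^ d

  private instance
    p^d≢0 : NonZero (p ^ d)
    p^d≢0 = m^n≢0 p d {{prime⇒nonZero p-prime}}

  G²-abelianGroup : AbelianGroup 0ℓ 0ℓ
  G²-abelianGroup = record { isAbelianGroup = +²-isAbelianGroup ds }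

  module G² = AbelianGroupProperties G²-abelianGroup

  module R where
    open AbelianGroup +F-abelianGroup public using (identityˡ; identityʳ; commutativeSemigroup)
    open AbelianGroupProperties +F-abelianGroup public
    open CommutativeSemigroupProperties commutativeSemigroup public using (interchange)

  module G-Pairings = Pairings (+G-isAbelianGroup ds) _≟G_ (elemsG ds) ∈-elemsG (elemsG! ds) p p-prime d
  module Dot = G-Pairings.BiadditiveForm (dot d) (dot-+ˡ ds≤d) (dot-+ʳ ds≤d)
  module G²-Pairings = Pairings (+²-isAbelianGroup ds) _≟²_ (elems² ds) ∈-elems² (elems²! ds) p p-prime d

  module ConditionLemmas (Bf : G² ds → G² ds → Fin (p ^ d)) where
    open Conditions d ds Bf

    G×0-witness : (∀ g g′ → Bf (g , 0G ds) (g′ , 0G ds) ≡ 0F) →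
                  ∃[ W ] (Unique W × Isotropic W × length W ≡ card ds)
    G×0-witness vanishes = G×0 , map⁺ (cong proj₁) (elemsG! ds) , G×0-isotropic ,
                           trans (length-map _ (elemsG ds)) (length-elemsG ds)
      where
      G×0 : List (G² ds)
      G×0 = map (_, 0G ds) (elemsG ds)
      G×0-isotropic : Isotropic G×0
      G×0-isotropic x∈ y∈ with _ , _ , refl ← ∈-map⁻ (_, 0G ds) x∈ | _ , _ , refl ← ∈-map⁻ (_, 0G ds) y∈ =
        vanishes _ _

    subgroup-⇔ : ∀ {W} {H : Pred (G² ds) 0ℓ} → (∀ {x} → x ∈ W → H x) → (∀ {h} → H h → h ∈ W) →
                 ∀ x → (x ∈ W) ⇔ (∃[ h ] (H h × x ≡ 0² ds +² h))
    subgroup-⇔ {W} W⊆H H⊆W x = mk⇔ (λ x∈W → x , W⊆H x∈W , sym (+²-identityˡ x))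
                                    λ { (h , Hh , refl) → subst (_∈ W) (sym (+²-identityˡ h)) (H⊆W Hh) }

    coset-⇔ : ∀ {W} {H : Pred (G² ds) 0ℓ} g′ → (∀ {x} → x ∈ W → H (x +² (-² g′))) →
              (∀ {h} → H h → (g′ +² h) ∈ W) → ∀ x → (x ∈ W) ⇔ (∃[ h ] (H h × x ≡ g′ +² h))
    coset-⇔ g′ W⊆g′+H g′+H⊆W x =
      mk⇔ (λ x∈W → x +² (-² g′) , W⊆g′+H x∈W , sym (x∙[y-x]≈y G²-abelianGroup g′ x))
          λ { (h , Hh , refl) → g′+H⊆W Hh }

    decSubgroup⇒subgroup : ∀ {H} → G²-Pairings.IsDecSubgroup H → IsSubgroup H
    decSubgroup⇒subgroup H-sub = ε∈ , (λ {x} {y} → ∙∈ {x} {y}) , λ {x} → ⁻¹∈ {x}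
      where open G²-Pairings.IsDecSubgroup H-sub

    nonConstantAffine : ∀ {H f} (φ : G² ds → Fin (p ^ d)) → (∀ x y → φ (x +² y) ≡ φ x +F φ y) → ∀ c →
                        (∀ {x} → H x → f x ≡ φ x +F c) → H (0² ds) → ∀ h → H h → φ h ≢ 0F →
                        NonConstantAffineOn H f
    nonConstantAffine φ φ-+ c f≡φ+c H0 h Hh φh≢0 =
      (φ , (λ _ _ → φ-+ _ _) , c , f≡φ+c) , _ , _ , Hh , H0 , λ fh≡f0 →
        φh≢0 (trans (R.∙-cancelʳ c _ _ (trans (sym (f≡φ+c Hh)) (trans fh≡f0 (f≡φ+c H0)))) φ.f-ε)
      where module φ = AdditiveMap (+²-isAbelianGroup ds) (p ^ d) φ φ-+

  module Case1 where
    open Conditions d ds (B d case1)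
    open ConditionLemmas (B d case1)
    open Counting _≟G_ (elemsG ds) ∈-elemsG (elemsG! ds)
    open import Data.List.Membership.DecPropositional (_≟G_ {ds}) using (_∈?_)
    open G-Pairings using (IsDecSubgroup; module IsDecSubgroup)
    open Dot using (_⊥; ⊥-isDecSubgroup; ∃-separating; ⊥⊆-by-count; count*count⊥≤|G|)
    open IsDecSubgroup

    nondegenerate : Dot.LeftNondegenerate
    nondegenerate = dot-nondegenerate ds≤d

    module _ {W} (W! : Unique W) (W-iso : Isotropic W) where
      A-sub : IsDecSubgroup ((_∈ map proj₂ W) ⊥)
      A-sub = ⊥-isDecSubgroup (_∈? map proj₂ W)

      C-sub : IsDecSubgroup (((_∈ map proj₂ W) ⊥) ⊥)
      C-sub = ⊥-isDecSubgroup (dec A-sub)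

      H : Pred (G² ds) 0ℓ
      H (g , h) = ((_∈ map proj₂ W) ⊥) g × (((_∈ map proj₂ W) ⊥) ⊥) h

      A×C : List (G² ds)
      A×C = cartesianProduct (listOf (dec A-sub)) (listOf (dec C-sub))

      W⊆H : ∀ {x} → x ∈ W → H x
      W⊆H {g , h} x∈W = g∈A , λ a a⊥ → trans (dot-comm a h) (a⊥ h (∈-map⁺ proj₂ x∈W))
        where
        g∈A : ((_∈ map proj₂ W) ⊥) g
        g∈A y y∈ with (_ , h′) , x′∈W , refl ← ∈-map⁻ proj₂ y∈ = trans (dot-comm h′ g) (W-iso x∈W x′∈W)

      W⊆A×C : W ⊆ A×C
      W⊆A×C x∈W = let Ag , Ch = W⊆H x∈W in ∈-cartesianProduct⁺ (∈-listOf⁺ (dec A-sub) Ag) (∈-listOf⁺ (dec C-sub) Ch)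

      |A×C|≤n : length A×C ≤ card ds
      |A×C|≤n = subst₂ _≤_ (sym (length-cartesianProductWith _,_ (listOf (dec A-sub)) (listOf (dec C-sub))))
                  (length-elemsG ds) (count*count⊥≤|G| nondegenerate A-sub)

      length≤n : length W ≤ card ds
      length≤n = ≤-trans (unique-⊆⇒length≤ W! W⊆A×C) |A×C|≤n

      module _ (|W|≡n : length W ≡ card ds) where
        H⊆W : ∀ {x} → H x → x ∈ W
        H⊆W (Ag , Ch) = unique-⊆-length≥⇒⊇ _≟²_ W! W⊆A×C (subst (length A×C ≤_) (sym |W|≡n) |A×C|≤n)
                          (∈-cartesianProduct⁺ (∈-listOf⁺ (dec A-sub) Ag) (∈-listOf⁺ (dec C-sub) Ch))

        C⊥⊆A : ∀ {a} → (((_∈ map proj₂ W) ⊥) ⊥ ⊥) a → ((_∈ map proj₂ W) ⊥) a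
        C⊥⊆A = ⊥⊆-by-count nondegenerate C-sub (dec A-sub) (λ Aa c Cc → trans (dot-comm c _) (Cc _ Aa))
                 (begin
                   length (elemsG ds)                        ≡⟨ trans (length-elemsG ds) (sym |W|≡n) ⟩
                   length W                                  ≤⟨ unique-⊆⇒length≤ W! W⊆A×C ⟩
                   length A×C                                ≡⟨ length-cartesianProductWith _,_ (listOf (dec A-sub)) (listOf (dec C-sub)) ⟩
                   count (dec A-sub) * count (dec C-sub)     ≡⟨ *-comm (count (dec A-sub)) (count (dec C-sub)) ⟩
                   count (dec C-sub) * count (dec A-sub)     ∎)
          where open ≤-Reasoning

    condI : CondI
    condI = (λ W W! W-iso → length≤n W! W-iso) , G×0-witness (λ g _ → Dot.Bʳ.f-ε g)

    condIII : CondIII Ω₁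
    condIII ()

    condII : CondII
    condII W W! W-iso |W|≡n = H W! W-iso , H-isSubgroup , 0² ds , subgroup-⇔ (W⊆H W! W-iso) (H⊆W W! W-iso |W|≡n) ,
                              nonconstant
      where
      A = A-sub W! W-iso
      C = C-sub W! W-iso

      H-isSubgroup : IsSubgroup (H W! W-iso)
      H-isSubgroup = (ε∈ A , ε∈ C) , (λ (Ag , Ch) (Ag′ , Ch′) → ∙∈ A Ag Ag′ , ∙∈ C Ch Ch′) ,
                     λ (Ag , Ch) → ⁻¹∈ A Ag , ⁻¹∈ C Ch

      nonconstant : ∀ g → g ∉ W → NonConstantAffineOn (H W! W-iso) (λ x → B d case1 (0² ds +² x) g)
                                 ⊎ NonConstantAffineOn (H W! W-iso) (λ x → B d case1 g (0² ds +² x))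
      nonconstant (a , c) g∉W with dec C c
      ... | no c∉C = let a₀ , Aa₀ , a₀·c≢0 = ∃-separating (dec A) c∉C in
        inj₁ (nonConstantAffine (λ x → dot d (proj₁ x) c) (λ x y → dot-+ˡ ds≤d (proj₁ x) (proj₁ y) c) 0F
               (λ {x} _ → trans (cong (λ y → dot d y c) (+G-identityˡ (proj₁ x))) (sym (R.identityʳ _)))
               (ε∈ A , ε∈ C) (a₀ , 0G ds) (Aa₀ , ε∈ C) a₀·c≢0)
      ... | yes c∈C =
        let c₀ , Cc₀ , c₀·a≢0 = ∃-separating (dec C) λ a∈C⊥ →
                                  g∉W (H⊆W W! W-iso |W|≡n (C⊥⊆A W! W-iso |W|≡n a∈C⊥ , c∈C)) in
        inj₂ (nonConstantAffine (λ x → dot d a (proj₂ x)) (λ x y → dot-+ʳ ds≤d a (proj₂ x) (proj₂ y)) 0F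
               (λ {x} _ → trans (cong (dot d a) (+G-identityˡ (proj₂ x))) (sym (R.identityʳ _)))
               (ε∈ A , ε∈ C) (0G ds , c₀) (ε∈ A , Cc₀) (c₀·a≢0 ∘ trans (dot-comm c₀ a)))

  -- Bσ is B₂ for σ = id and B₃ for σ = −.
  module Twisted (σ : Fin (p ^ d) → Fin (p ^ d)) (σ-+ : ∀ a b → σ (a +F b) ≡ σ a +F σ b)
                 (σ-involutive : ∀ a → σ (σ a) ≡ a) where
    open ≡-Reasoning

    Bσ : G² ds → G² ds → Fin (p ^ d)
    Bσ (g , h) (g′ , h′) = dot d g h′ +F σ (dot d g′ h)

    σ-0 : σ 0F ≡ 0F
    σ-0 = AdditiveMap.f-ε +F-isAbelianGroup (p ^ d) σ σ-+

    σ≡0⇒≡0 : ∀ {a} → σ a ≡ 0F → a ≡ 0F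
    σ≡0⇒≡0 {a} σa≡0 = trans (sym (σ-involutive a)) (trans (cong σ σa≡0) σ-0)

    Bσ-+ˡ : ∀ x y z → Bσ (x +² y) z ≡ Bσ x z +F Bσ y z
    Bσ-+ˡ (g , h) (g′ , h′) (g″ , h″) = begin
      dot d (g +G g′) h″ +F σ (dot d g″ (h +G h′))
        ≡⟨ cong₂ _+F_ (dot-+ˡ ds≤d g g′ h″) (trans (cong σ (dot-+ʳ ds≤d g″ h h′)) (σ-+ _ _)) ⟩
      (dot d g h″ +F dot d g′ h″) +F (σ (dot d g″ h) +F σ (dot d g″ h′))
        ≡⟨ R.interchange (dot d g h″) (dot d g′ h″) (σ (dot d g″ h)) (σ (dot d g″ h′)) ⟩
      (dot d g h″ +F σ (dot d g″ h)) +F (dot d g′ h″ +F σ (dot d g″ h′)) ∎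

    Bσ-+ʳ : ∀ x y z → Bσ x (y +² z) ≡ Bσ x y +F Bσ x z
    Bσ-+ʳ (g , h) (g′ , h′) (g″ , h″) = begin
      dot d g (h′ +G h″) +F σ (dot d (g′ +G g″) h)
        ≡⟨ cong₂ _+F_ (dot-+ʳ ds≤d g h′ h″) (trans (cong σ (dot-+ˡ ds≤d g′ g″ h)) (σ-+ _ _)) ⟩
      (dot d g h′ +F dot d g h″) +F (σ (dot d g′ h) +F σ (dot d g″ h))
        ≡⟨ R.interchange (dot d g h′) (dot d g h″) (σ (dot d g′ h)) (σ (dot d g″ h)) ⟩
      (dot d g h′ +F σ (dot d g′ h)) +F (dot d g h″ +F σ (dot d g″ h)) ∎

    Bσ-flip : ∀ x y → Bσ y x ≡ σ (Bσ x y)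
    Bσ-flip (g , h) (g′ , h′) = begin
      dot d g′ h +F σ (dot d g h′)           ≡⟨ +F-comm (dot d g′ h) (σ (dot d g h′)) ⟩
      σ (dot d g h′) +F dot d g′ h           ≡⟨ cong (σ (dot d g h′) +F_) (σ-involutive _) ⟨
      σ (dot d g h′) +F σ (σ (dot d g′ h))   ≡⟨ σ-+ (dot d g h′) (σ (dot d g′ h)) ⟨
      σ (dot d g h′ +F σ (dot d g′ h))       ∎

    Bσ-reflexive : ∀ {x y} → Bσ x y ≡ 0F → Bσ y x ≡ 0F
    Bσ-reflexive {x} {y} Bxy≡0 = trans (Bσ-flip x y) (trans (cong σ Bxy≡0) σ-0)

    Bσ-vanishes-on-G×0 : ∀ g g′ → Bσ (g , 0G ds) (g′ , 0G ds) ≡ 0F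
    Bσ-vanishes-on-G×0 g g′ =
      trans (cong₂ (λ a b → a +F σ b) (Dot.Bʳ.f-ε g) (Dot.Bʳ.f-ε g′)) (trans (cong (0F +F_) σ-0) (+F-identityˡ 0F))

    Bσ-nondegenerate : G²-Pairings.BiadditiveForm.LeftNondegenerate Bσ Bσ-+ˡ Bσ-+ʳ
    Bσ-nondegenerate (g , h) g,h≢0 with g ≟G 0G ds
    ... | no g≢0 = let y , g·y≢0 = dot-nondegenerate ds≤d g g≢0 in
      (0G ds , y) , λ B≡0 → g·y≢0 (begin
        dot d g y                            ≡⟨ R.identityʳ _ ⟨
        dot d g y +F 0F                      ≡⟨ cong (dot d g y +F_) (trans (cong σ (Dot.Bˡ.f-ε h)) σ-0) ⟨
        dot d g y +F σ (dot d (0G ds) h)     ≡⟨ B≡0 ⟩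
        0F                                   ∎)
    ... | yes refl = let y , h·y≢0 = dot-nondegenerate ds≤d h (g,h≢0 ∘ cong (0G ds ,_)) in
      (y , 0G ds) , λ B≡0 → h·y≢0 (trans (dot-comm h y) (σ≡0⇒≡0 (begin
        σ (dot d y h)                            ≡⟨ +F-identityˡ _ ⟨
        0F +F σ (dot d y h)                      ≡⟨ cong (_+F σ (dot d y h)) (Dot.Bʳ.f-ε (0G ds)) ⟨
        dot d (0G ds) (0G ds) +F σ (dot d y h)   ≡⟨ B≡0 ⟩
        0F                                       ∎)))

    module Fσ = G²-Pairings.BiadditiveForm Bσ Bσ-+ˡ Bσ-+ʳ
    module Closure {W} (W! : Unique W) (W-iso : Fσ.Isotropic W) =
      Fσ.Reflexive (λ {x} {y} → Bσ-reflexive {x} {y}) Bσ-nondegenerate {card ds} (length-elems² ds) W! W-iso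

    open Conditions d ds Bσ
    open ConditionLemmas Bσ

    condI : CondI
    condI = (λ W W! W-iso → Closure.length≤n W! W-iso) , G×0-witness Bσ-vanishes-on-G×0

    condII : CondII
    condII W W! W-iso |W|≡n = closure , decSubgroup⇒subgroup closure-isDecSubgroup , 0² ds ,
      subgroup-⇔ ⊆closure (closure⊆ |W|≡n) ,
      λ g g∉W → let c , Cc , Bcg≢0 = ∉⇒separated |W|≡n {g} g∉W in
        inj₁ (nonConstantAffine (λ x → Bσ x g) (λ x y → Bσ-+ˡ x y g) 0F
               (λ {x} _ → trans (cong (λ y → Bσ y g) (+²-identityˡ x)) (sym (R.identityʳ (Bσ x g)))) ε∈ c Cc Bcg≢0)
      where
      open Closure W! W-iso
      open G²-Pairings.IsDecSubgroup closure-isDecSubgroup using (ε∈)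

  module Case2 where
    open Twisted id (λ _ _ → refl) (λ _ → refl) public
    open Conditions d ds (B d case2) using (CondIII)

    condIII : CondIII Ω₂
    condIII _ = inj₁ λ x y → sym (Bσ-flip x y)

  module Case3 where
    open Twisted -F_ (λ a b → sym (R.⁻¹-∙-comm a b)) R.⁻¹-involutive public
    open Conditions d ds (B d case3) using (CondIII)

    condIII : CondIII Ω₂
    condIII _ = inj₂ λ (g , h) → +F-inverseʳ (dot d g h)

  module Case4 where
    open Conditions d ds (B d case4)
    open ConditionLemmas (B d case4)
    open Case2 using () renaming (Bσ to B₂; Bσ-+ˡ to B₂-+ˡ)
    open ≡-Reasoning

    _-²_ : G² ds → G² ds → G² ds
    x -² y = x +² (-² y)

    -- B d case4 x y unfolds to -F Q (x -² y), and B₂ is the polar form of Q (Q-+).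
    Q : G² ds → Fin (p ^ d)
    Q (g , h) = dot d g h

    Q-+ : ∀ x y → Q (x +² y) ≡ (Q x +F Q y) +F B₂ x y
    Q-+ (g , h) (g′ , h′) = begin
      dot d (g +G g′) (h +G h′)
        ≡⟨ dot-+ˡ ds≤d g g′ (h +G h′) ⟩
      dot d g (h +G h′) +F dot d g′ (h +G h′)
        ≡⟨ cong₂ _+F_ (dot-+ʳ ds≤d g h h′) (dot-+ʳ ds≤d g′ h h′) ⟩
      (dot d g h +F dot d g h′) +F (dot d g′ h +F dot d g′ h′)
        ≡⟨ cong ((dot d g h +F dot d g h′) +F_) (+F-comm (dot d g′ h) (dot d g′ h′)) ⟩
      (dot d g h +F dot d g h′) +F (dot d g′ h′ +F dot d g′ h)
        ≡⟨ R.interchange (dot d g h) (dot d g h′) (dot d g′ h′) (dot d g′ h) ⟩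
      (dot d g h +F dot d g′ h′) +F (dot d g h′ +F dot d g′ h) ∎

    Q-⁻¹ : ∀ x → Q (-² x) ≡ Q x
    Q-⁻¹ (g , h) = trans (Dot.Bˡ.f-⁻¹ (-G h) g) (trans (cong -F_ (Dot.Bʳ.f-⁻¹ g h)) (R.⁻¹-involutive (dot d g h)))

    condIII : CondIII Ω₂
    condIII _ = inj₁ λ x y → cong -F_ (trans (sym (Q-⁻¹ (x -² y))) (cong Q (G².⁻¹-anti-homo‿- x y)))

    module _ {W} (W! : Unique W) (W-iso : Isotropic W) {w₀} (w₀∈W : w₀ ∈ W) where
      V : List (G² ds)
      V = map (_-² w₀) W

      V! : Unique V
      V! = map⁺ (λ {x} {y} → G².∙-cancelʳ (-² w₀) x y) W!

      Q-V : ∀ {v} → v ∈ V → Q v ≡ 0F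
      Q-V v∈V with y , y∈W , refl ← ∈-map⁻ (_-² w₀) v∈V = -F≡0F⇒≡0F (W-iso y∈W w₀∈W)

      V-isotropic : Case2.Fσ.Isotropic V
      V-isotropic v∈V v′∈V with y , y∈W , refl ← ∈-map⁻ (_-² w₀) v∈V
                           | y′ , y′∈W , refl ← ∈-map⁻ (_-² w₀) v′∈V = -F≡0F⇒≡0F (begin
        -F B₂ v v′                                  ≡⟨ +F-identityˡ (-F B₂ v v′) ⟨
        0F +F (-F B₂ v v′)                          ≡⟨ cong₂ _+F_ Qv+Q[-v′]≡0 (Case2.Fσ.Bʳ.f-⁻¹ v v′) ⟨
        (Q v +F Q (-² v′)) +F B₂ v (-² v′)          ≡⟨ Q-+ v (-² v′) ⟨
        Q (v -² v′)                                 ≡⟨ cong Q (x∙z-y∙z≈x-y G²-abelianGroup y y′ (-² w₀)) ⟩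
        Q (y -² y′)                                 ≡⟨ -F≡0F⇒≡0F (W-iso y∈W y′∈W) ⟩
        0F                                          ∎)
        where
        v = y -² w₀
        v′ = y′ -² w₀
        Qv+Q[-v′]≡0 : Q v +F Q (-² v′) ≡ 0F
        Qv+Q[-v′]≡0 = trans (cong₂ _+F_ (Q-V v∈V) (trans (Q-⁻¹ v′) (Q-V v′∈V))) (+F-identityˡ 0F)

      open Case2.Closure V! V-isotropic public

    condI : CondI
    condI = length≤n′ , G×0-witness vanishes
      where
      length≤n′ : ∀ W → Unique W → Isotropic W → length W ≤ card ds
      length≤n′ []       _  _     = z≤n
      length≤n′ (w ∷ W) W! W-iso = subst (_≤ card ds) (length-map (_-² w) (w ∷ W)) (length≤n W! W-iso (here refl))
      vanishes : ∀ g g′ → B d case4 (g , 0G ds) (g′ , 0G ds) ≡ 0F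
      vanishes g g′ = trans (cong (λ h → -F dot d (g +G (-G g′)) h) (+G-inverseʳ (0G ds)))
                            (trans (cong -F_ (Dot.Bʳ.f-ε (g +G (-G g′)))) -F0F≡0F)

    condII : CondII
    condII []       _  _     |[]|≡n = ⊥-elim (<⇒≢ (subst (0 <_) (length-elemsG ds) (∈-length (∈-elemsG (0G ds)))) |[]|≡n)
    condII (w₀ ∷ W′) W! W-iso |W|≡n =
      closure W! W-iso w₀∈W , decSubgroup⇒subgroup (closure-isDecSubgroup W! W-iso w₀∈W) , w₀ ,
      coset-⇔ w₀ (λ x∈W → ⊆closure W! W-iso w₀∈W (∈-map⁺ (_-² w₀) x∈W))
                 (λ Hh → w₀+V⊆W (closure⊆ W! W-iso w₀∈W |V|≡n Hh)) ,
      λ g g∉W → let c₀ , Hc₀ , B₂c₀z≢0 = ∉⇒separated W! W-iso w₀∈W |V|≡n {g -² w₀} (translate-∉ g∉W) in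
        inj₁ (nonConstantAffine (λ x → B₂ x (g -² w₀)) (λ x y → B₂-+ˡ x y (g -² w₀)) (-F Q (g -² w₀))
                                (affine g) ε∈ c₀ Hc₀ B₂c₀z≢0)
      where
      W = w₀ ∷ W′
      w₀∈W : w₀ ∈ W
      w₀∈W = here refl
      open G²-Pairings.IsDecSubgroup (closure-isDecSubgroup W! W-iso w₀∈W) using (ε∈)
      |V|≡n : length (V W! W-iso w₀∈W) ≡ card ds
      |V|≡n = trans (length-map (_-² w₀) W) |W|≡n
      w₀+V⊆W : ∀ {h} → h ∈ V W! W-iso w₀∈W → (w₀ +² h) ∈ W
      w₀+V⊆W h∈V with y , y∈W , refl ← ∈-map⁻ (_-² w₀) h∈V =
        subst (_∈ W) (sym (x∙[y-x]≈y G²-abelianGroup w₀ y)) y∈W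

      translate-∉ : ∀ {g} → g ∉ W → (g -² w₀) ∉ V W! W-iso w₀∈W
      translate-∉ g∉W g-w₀∈V with y , y∈W , g-w₀≡y-w₀ ← ∈-map⁻ (_-² w₀) g-w₀∈V =
        g∉W (subst (_∈ W) (sym (G².∙-cancelʳ (-² w₀) _ y g-w₀≡y-w₀)) y∈W)

      affine : ∀ g {x} → closure W! W-iso w₀∈W x → B d case4 (w₀ +² x) g ≡ B₂ x (g -² w₀) +F (-F Q (g -² w₀))
      affine g {x} Hx = begin
        -F Q ((w₀ +² x) -² g)                      ≡⟨ cong (-F_ ∘ Q) (w∙x-y≈x-[y-w] G²-abelianGroup w₀ x g) ⟩
        -F Q (x -² z)                              ≡⟨ cong -F_ (Q-+ x (-² z)) ⟩
        -F ((Q x +F Q (-² z)) +F B₂ x (-² z))      ≡⟨ cong -F_ (cong₂ _+F_ Qx+Q[-z]≡Qz (Case2.Fσ.Bʳ.f-⁻¹ x z)) ⟩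
        -F (Q z +F (-F B₂ x z))                    ≡⟨ R.⁻¹-anti-homo‿- (Q z) (B₂ x z) ⟩
        B₂ x z +F (-F Q z)                         ∎
        where
        z = g -² w₀
        Qx+Q[-z]≡Qz : Q x +F Q (-² z) ≡ Q z
        Qx+Q[-z]≡Qz = trans (cong₂ _+F_ (Q-V W! W-iso w₀∈W {x} (closure⊆ W! W-iso w₀∈W |V|≡n Hx)) (Q-⁻¹ z))
                            (+F-identityˡ (Q z))

lemma2p1 : (p : ℕ) (pp : Prime p) (d : ℕ) (ds : List ℕ)
    → Linked _≥_ ds → All (_≤ d) ds → All (1 ≤_) ds
    → (c : Case)
    → let open Setup p {{prime⇒nonZero pp}}
          open Conditions d ds (B d c)
      in CondI × CondII × CondIII (omega c)
lemma2p1 p pp d ds _ ds≤d _ case1 = Case1.condI , Case1.condII , Case1.condIII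
  where open Cases p pp d ds ds≤d
lemma2p1 p pp d ds _ ds≤d _ case2 = Case2.condI , Case2.condII , Case2.condIII
  where open Cases p pp d ds ds≤d
lemma2p1 p pp d ds _ ds≤d _ case3 = Case3.condI , Case3.condII , Case3.condIII
  where open Cases p pp d ds ds≤d
lemma2p1 p pp d ds _ ds≤d _ case4 = Case4.condI , Case4.condII , Case4.condIII
  where open Cases p pp d ds ds≤d
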